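{- Let $r>1$, $n\ge 1$ and let $R$ be a commutative ring with one. The set $\{E_\mu:\mu\text{ a signed composition of }n\}$ is linearly independent over $R$ in the group algebra $RG_{r,n}$.
   Context: $G_{r,n}$ is the group with generators $s_0,\dots,s_{n-1}$ and relations $s_0^r=1$, $s_i^2=1$ ($1\le i\le n-1$), $s_0s_1s_0s_1=s_1s_0s_1s_0$, $s_is_j=s_js_i$ for $|i-j|>1$, $s_is_{i+1}s_i=s_{i+1}s_is_{i+1}$ ($1\le i\le n-2$). Put $t_1=s_0$, $t_{i+1}=s_it_is_i$, $\Pi=\{t_1,\dots,t_n,s_1,\dots,s_{n-1}\}$, and let $\ell(g)$ be the minimal number of elements of $\Pi$ whose product is $g$. A signed composition of $n$ is a sequence $\mu=(\mu_1,\dots,\mu_k)$ of nonzero integers with $\sum|\mu_i|=n$; put $\bar\mu_i=|\mu_1|+\dots+|\mu_i|$, $\bar\mu_0=0$. $\Pi_\mu$ consists of all $s_j$ with $\bar\mu_{i-1}<j<\bar\mu_i$ for some $i$, and all $t_j$ with $\bar\mu_{i-1}<j\le\bar\mu_i$ for some $i$ with $\mu_i>0$; $G_\mu=\langle\Pi_\mu\rangle$. $\mathscr E_\mu=\{e\in G_{r,n}:\ell(e)\le\ell(g)\ \forall g\in G_\mu e\}$ and $E_\mu=\sum_{e\in\mathscr E_\mu}e\in RG_{r,n}$. -}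

module Defs where

open import Data.Nat using (ℕ; zero; suc; _+_; _≤_; _<_)
open import Data.Integer as ℤ using (ℤ; ∣_∣; 0ℤ)
open import Data.Fin using (Fin; zero; suc; toℕ; inject₁)
open import Data.Bool using (Bool; true; false; not; if_then_else_)
open import Data.List using (List; []; _∷_; _++_; map; concatMap; replicate; reverse; length; foldr)
open import Data.Nat.ListAction using (sum)
open import Data.List.Relation.Unary.All using (All)
open import Data.List.Relation.Unary.Any using (Any)
open import Data.Product using (Σ; _×_; _,_; proj₁)
open import Relation.Binary.PropositionalEquality using (_≡_; _≢_)
open import Relation.Nullary using (Dec)
open import Relation.Nullary.Decidable using (⌊_⌋)
open import Algebra.Bundles using (CommutativeRing)

IsSignedComp : ℕ → List ℤ → Set
IsSignedComp n μ = All (λ x → x ≢ 0ℤ) μ × sum (map ∣_∣ μ) ≡ n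

-- blocks a μ lists the triples (μ̄_{i-1}, μ̄_i, μ_i) (offset by a)
blocks : ℕ → List ℤ → List (ℕ × ℕ × ℤ)
blocks a []       = []
blocks a (z ∷ zs) = (a , a + ∣ z ∣ , z) ∷ blocks (a + ∣ z ∣) zs

module G (r n : ℕ) where

  -- a letter (i , true) is the generator s_i, (i , false) is s_i⁻¹
  Letter : Set
  Letter = Fin n × Bool

  Word : Set
  Word = List Letter

  gen : Fin n → Letter
  gen i = (i , true)

  flipL : Letter → Letter
  flipL (i , b) = (i , not b)

  invW : Word → Word
  invW w = reverse (map flipL w)

  data Base : Word → Word → Set where
    inv   : ∀ i b → Base ((i , b) ∷ (i , not b) ∷ []) []
    ord0  : ∀ i → toℕ i ≡ 0 → Base (replicate r (gen i)) []
    ordI  : ∀ i → 1 ≤ toℕ i → Base (gen i ∷ gen i ∷ []) []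
    rel01 : ∀ i j → toℕ i ≡ 0 → toℕ j ≡ 1 →
            Base (gen i ∷ gen j ∷ gen i ∷ gen j ∷ []) (gen j ∷ gen i ∷ gen j ∷ gen i ∷ [])
    comm  : ∀ i j → suc (toℕ i) < toℕ j → Base (gen i ∷ gen j ∷ []) (gen j ∷ gen i ∷ [])
    braid : ∀ i j → 1 ≤ toℕ i → toℕ j ≡ suc (toℕ i) →
            Base (gen i ∷ gen j ∷ gen i ∷ []) (gen j ∷ gen i ∷ gen j ∷ [])

  infix 4 _≈G_
  data _≈G_ : Word → Word → Set where
    step   : ∀ x u v y → Base u v → (x ++ u ++ y) ≈G (x ++ v ++ y)
    ≈refl  : ∀ {u} → u ≈G u
    ≈sym   : ∀ {u v} → u ≈G v → v ≈G u
    ≈trans : ∀ {u v w} → u ≈G v → v ≈G w → u ≈G w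

  -- tword i is the word t_{i+1}: t_1 = s_0, t_{k+1} = s_k t_k s_k
  tword : ∀ {m} → Fin m → List (Fin m)
  tword zero    = zero ∷ []
  tword (suc i) = suc i ∷ (map inject₁ (tword i) ++ suc i ∷ [])

  -- the set Π : tE j is t_{j+1} (0 ≤ j < n), sE j _ is s_j (1 ≤ j < n)
  data PiElt : Set where
    tE : Fin n → PiElt
    sE : (j : Fin n) → 1 ≤ toℕ j → PiElt

  piWord : PiElt → Word
  piWord (tE j)   = map gen (tword j)
  piWord (sE j _) = gen j ∷ []

  ProdLen : Word → ℕ → Set
  ProdLen w k = Σ (List PiElt) λ ps → length ps ≡ k × concatMap piWord ps ≈G w

  -- ℓ(w) ≤ ℓ(v), unfolded (ℓ is the minimum of the k with ProdLen _ k)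
  LenLe : Word → Word → Set
  LenLe w v = ∀ k → ProdLen v k → Σ ℕ λ k' → k' ≤ k × ProdLen w k'

  InΠ : List ℤ → PiElt → Set
  InΠ μ (tE j)   = Any (λ blk → Σ ℕ λ a → Σ ℕ λ b → Σ ℤ λ z → blk ≡ (a , b , z) ×
                          (a < suc (toℕ j) × suc (toℕ j) ≤ b × 0ℤ ℤ.< z)) (blocks 0 μ)
  InΠ μ (sE j _) = Any (λ blk → Σ ℕ λ a → Σ ℕ λ b → Σ ℤ λ z → blk ≡ (a , b , z) ×
                          (a < toℕ j × toℕ j < b)) (blocks 0 μ)

  signedWord : PiElt × Bool → Word
  signedWord (p , true)  = piWord p
  signedWord (p , false) = invW (piWord p)

  InG : List ℤ → Word → Set
  InG μ h = Σ (List (PiElt × Bool)) λ ps →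
              All (λ pb → InΠ μ (proj₁ pb)) ps × concatMap signedWord ps ≈G h

  ℰ : List ℤ → Word → Set
  ℰ μ e = ∀ h → InG μ h → LenLe e (h ++ e)

-- coefficient of g in Σ_{μ ∈ L} c_μ E_μ, given a decision procedure
-- for membership of g in the sets ℰ_μ

module _ {c ℓ} (R : CommutativeRing c ℓ) where
  open CommutativeRing R using (Carrier; 0#) renaming (_+_ to _+R_)

  coeffAt : (L : List (List ℤ)) (coef : List ℤ → Carrier)
            {P : List ℤ → Set} → (∀ μ → Dec (P μ)) → Carrier
  coeffAt L coef d = foldr _+R_ 0# (map (λ μ → if ⌊ d μ ⌋ then coef μ else 0#) L)

-- For every μ we build a test element g_μ with g_μ ∈ ℰ_ν ⇔ μ ≼ ν, where μ ≼ ν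
-- ("dominates μ ν") says that every block boundary of μ is one of ν and every
-- position outside the positive blocks of μ is outside those of ν.  Since ≼ is
-- reflexive and strictly raises a bounded weight (Weights, via Profiles: a
-- composition is determined by its boundaries and signs), the coefficients of
-- Σ c_ν E_ν at the g_μ form a unitriangular system (TestCoefficients,
-- Unitriangular), so a vanishing combination has all c_ν = 0.
--
-- Lengths are bounded through a homomorphic image of G_{r,n} in coloured
-- permutations (Model): for each ν the statistic Θ_ν (block-crossing inversions
-- plus coloured positions outside positive ν-blocks) grows by at most one per
-- element of Π and is invariant under G_ν (Statistic, LengthBound).  The test
-- word (Runs … TestLength) has Θ_ν ≥ its length when μ ≼ ν, and a left descent
-- in Π_ν otherwise (SwapST, MoveT, RunDescents, TestDescents); TestElements
-- combines these.

module Submission where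

open import Defs
open import Data.Nat using (ℕ; suc; pred; _<_; _≤_; s≤s; z≤n)
open import Data.Integer as ℤ using (ℤ)
open import Data.Bool using (Bool; true; false; if_then_else_)
open import Data.List using (List)
open import Data.List.Properties using (≡-dec)
open import Data.List.Relation.Unary.All using (All)
import Data.List.Relation.Unary.All as AllM
open import Data.List.Relation.Unary.Unique.Propositional using (Unique)
open import Relation.Nullary using (Dec)
open import Relation.Binary.Definitions using (DecidableEquality)
open import Relation.Binary.PropositionalEquality using (_≡_)
open import Algebra.Bundles using (CommutativeRing)

module Counting where

  open import Data.Nat
  open import Data.Nat.Properties
  open import Data.Product using (_×_; _,_; proj₁; proj₂)
  open import Data.Sum using (_⊎_; inj₁; inj₂)
  open import Data.Empty using (⊥; ⊥-elim)
  open import Relation.Nullary using (Dec; yes; no; ¬_; does; isYes)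
  open import Relation.Nullary.Negation using (contradiction)
  open import Relation.Binary.PropositionalEquality hiding ([_])
  open import Data.Bool using (true; false)
  open import Data.List using (List; []; _∷_; _++_)
  open import Algebra.Properties.CommutativeSemigroup +-commutativeSemigroup
    using () renaming (interchange to +-interchange)

  ⟦_⟧ : ∀ {p} {P : Set p} → Dec P → ℕ
  ⟦ yes _ ⟧ = 1
  ⟦ no _ ⟧ = 0

  ⟦⟧-mono : ∀ {p q} {P : Set p} {Q : Set q} (P? : Dec P) (Q? : Dec Q) → (P → Q) → ⟦ P? ⟧ ≤ ⟦ Q? ⟧
  ⟦⟧-mono (yes p) (yes q) f = ≤-refl
  ⟦⟧-mono (yes p) (no ¬q) f = contradiction (f p) ¬q
  ⟦⟧-mono (no ¬p) Q? f = z≤n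

  ⟦⟧-cong : ∀ {p q} {P : Set p} {Q : Set q} (P? : Dec P) (Q? : Dec Q) → (P → Q) → (Q → P) → ⟦ P? ⟧ ≡ ⟦ Q? ⟧
  ⟦⟧-cong P? Q? f g = ≤-antisym (⟦⟧-mono P? Q? f) (⟦⟧-mono Q? P? g)

  ⟦⟧-mono⊎ : ∀ {p q e} {P : Set p} {Q : Set q} {E : Set e} (P? : Dec P) (Q? : Dec Q) (E? : Dec E) →
             (P → Q ⊎ E) → ⟦ P? ⟧ ≤ ⟦ Q? ⟧ + ⟦ E? ⟧
  ⟦⟧-mono⊎ (no _) Q? E? f = z≤n
  ⟦⟧-mono⊎ (yes p) (yes _) E? f = s≤s z≤n
  ⟦⟧-mono⊎ (yes p) (no ¬q) (yes _) f = s≤s z≤n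
  ⟦⟧-mono⊎ (yes p) (no ¬q) (no ¬e) f with f p
  ... | inj₁ q = contradiction q ¬q
  ... | inj₂ e = contradiction e ¬e

  ⟦⟧-no : ∀ {p} {P : Set p} (P? : Dec P) → ¬ P → ⟦ P? ⟧ ≡ 0
  ⟦⟧-no (yes p) ¬p = contradiction p ¬p
  ⟦⟧-no (no _) _ = refl

  ⟦⟧-yes : ∀ {p} {P : Set p} (P? : Dec P) → P → ⟦ P? ⟧ ≡ 1
  ⟦⟧-yes (yes _) _ = refl
  ⟦⟧-yes (no ¬p) p = contradiction p ¬p

  ⟦⟧≤1 : ∀ {p} {P : Set p} (P? : Dec P) → ⟦ P? ⟧ ≤ 1
  ⟦⟧≤1 (yes _) = s≤s z≤n
  ⟦⟧≤1 (no _) = z≤n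

  true≢false : true ≡ false → ⊥
  true≢false ()


  does-true : ∀ {P : Set} (d : Dec P) → does d ≡ true → P
  does-true (yes p) _ = p
  does-true (no _) ()

  does-iff : ∀ {P Q : Set} (d : Dec P) (d' : Dec Q) → (P → Q) → (Q → P) → does d ≡ does d'
  does-iff (yes p) (yes q) f g = refl
  does-iff (yes p) (no ¬q) f g = ⊥-elim (¬q (f p))
  does-iff (no ¬p) (yes q) f g = ⊥-elim (¬p (g q))
  does-iff (no ¬p) (no ¬q) f g = refl

  does-eq-iff : ∀ {P Q : Set} (d : Dec P) (d' : Dec Q) → does d ≡ does d' → (P → Q) × (Q → P)
  does-eq-iff (yes p) (yes q) _ = (λ _ → q) , (λ _ → p)
  does-eq-iff (no ¬p) (no ¬q) _ = (λ p → ⊥-elim (¬p p)) , (λ q → ⊥-elim (¬q q))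

  isYes≡does : ∀ {P : Set} (d : Dec P) → isYes d ≡ does d
  isYes≡does (yes _) = refl
  isYes≡does (no _) = refl

  Σ< : ℕ → (ℕ → ℕ) → ℕ
  Σ< zero f = 0
  Σ< (suc n) f = Σ< n f + f n

  Σ-ext : ∀ n {f g : ℕ → ℕ} → (∀ u → u < n → f u ≡ g u) → Σ< n f ≡ Σ< n g
  Σ-ext zero h = refl
  Σ-ext (suc n) h = cong₂ _+_ (Σ-ext n (λ u u<n → h u (m<n⇒m<1+n u<n))) (h n ≤-refl)

  Σ-mono : ∀ n {f g : ℕ → ℕ} → (∀ u → u < n → f u ≤ g u) → Σ< n f ≤ Σ< n g
  Σ-mono zero h = z≤n
  Σ-mono (suc n) h = +-mono-≤ (Σ-mono n (λ u u<n → h u (m<n⇒m<1+n u<n))) (h n ≤-refl)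

  Σ-+ : ∀ n (f g : ℕ → ℕ) → Σ< n (λ u → f u + g u) ≡ Σ< n f + Σ< n g
  Σ-+ zero f g = refl
  Σ-+ (suc n) f g = trans (cong (_+ (f n + g n)) (Σ-+ n f g)) (+-interchange (Σ< n f) (Σ< n g) (f n) (g n))

  Σ-zero : ∀ n {f : ℕ → ℕ} → (∀ u → u < n → f u ≡ 0) → Σ< n f ≡ 0
  Σ-zero zero h = refl
  Σ-zero (suc n) h rewrite Σ-zero n (λ u u<n → h u (m<n⇒m<1+n u<n)) | h n ≤-refl = refl

  Σ-point : ∀ n k (f : ℕ → ℕ) → (∀ u → u ≢ k → f u ≡ 0) → Σ< n f ≤ f k
  Σ-point zero k f h = z≤n
  Σ-point (suc n) k f h with n ≟ k
  ... | yes refl rewrite Σ-zero n {f} (λ u u<n → h u (<⇒≢ u<n)) = ≤-refl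
  ... | no n≢k rewrite h n n≢k | +-identityʳ (Σ< n f) = Σ-point n k f h


  Σ-ones : ∀ m → Σ< m (λ _ → 1) ≡ m
  Σ-ones zero = refl
  Σ-ones (suc m) = trans (cong (_+ 1) (Σ-ones m)) (+-comm m 1)

  +-tight : ∀ {a b c d} → a ≤ b → c ≤ d → a + c ≡ b + d → a ≡ b × c ≡ d
  +-tight {a} {b} {c} {d} ab cd e with m≤n⇒m<n∨m≡n ab
  ... | inj₂ refl = refl , +-cancelˡ-≡ a c d e
  ... | inj₁ lt = ⊥-elim (<-irrefl e (+-mono-<-≤ lt cd))

  Σ-tight : ∀ m (f g : ℕ → ℕ) → (∀ u → u < m → f u ≤ g u) → Σ< m f ≡ Σ< m g → ∀ u → u < m → f u ≡ g u
  Σ-tight (suc m) f g h e u u<m with +-tight (Σ-mono m (λ v v<m → h v (<-trans v<m (n<1+n m)))) (h m (n<1+n m)) e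
  ... | e1 , e2 with m≤n⇒m<n∨m≡n (≤-pred u<m)
  ...   | inj₁ lt = Σ-tight m f g (λ v v<m → h v (<-trans v<m (n<1+n m))) e1 u lt
  ...   | inj₂ refl = e2

  -- sw m is the transposition (m m+1) of ℕ: the permutation of the generator
  -- s_{m+1} in the model, and the reindexing along which sums are invariant.
  sw : ℕ → ℕ → ℕ
  sw zero zero = 1
  sw zero (suc zero) = 0
  sw zero (suc (suc u)) = suc (suc u)
  sw (suc m) zero = zero
  sw (suc m) (suc u) = suc (sw m u)

  sw-inv : ∀ m u → sw m (sw m u) ≡ u
  sw-inv zero zero = refl
  sw-inv zero (suc zero) = refl
  sw-inv zero (suc (suc u)) = refl
  sw-inv (suc m) zero = refl
  sw-inv (suc m) (suc u) = cong suc (sw-inv m u)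

  sw-m : ∀ m → sw m m ≡ suc m
  sw-m zero = refl
  sw-m (suc m) = cong suc (sw-m m)

  sw-sm : ∀ m → sw m (suc m) ≡ m
  sw-sm zero = refl
  sw-sm (suc m) = cong suc (sw-sm m)

  sw-id : ∀ m u → u ≢ m → u ≢ suc m → sw m u ≡ u
  sw-id zero zero h1 h2 = contradiction refl h1
  sw-id zero (suc zero) h1 h2 = contradiction refl h2
  sw-id zero (suc (suc u)) h1 h2 = refl
  sw-id (suc m) zero h1 h2 = refl
  sw-id (suc m) (suc u) h1 h2 = cong suc (sw-id m u (λ e → h1 (cong suc e)) (λ e → h2 (cong suc e)))

  sw-lt : ∀ m u → u < m → sw m u ≡ u
  sw-lt m u u<m = sw-id m u (<⇒≢ u<m) (<⇒≢ (m<n⇒m<1+n u<m))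

  sw-gt : ∀ m u → suc m < u → sw m u ≡ u
  sw-gt m u lt = sw-id m u (λ e → <-irrefl (sym e) (<-trans (n<1+n m) lt)) (λ e → <-irrefl (sym e) lt)

  sw-far : ∀ m k u → suc m < k → sw m (sw k u) ≡ sw k (sw m u)
  sw-far zero zero u ()
  sw-far zero (suc zero) u (s≤s ())
  sw-far zero (suc (suc k)) zero lt = refl
  sw-far zero (suc (suc k)) (suc zero) lt = refl
  sw-far zero (suc (suc k)) (suc (suc u)) lt = refl
  sw-far (suc m) (suc k) zero lt = refl
  sw-far (suc m) (suc k) (suc u) (s≤s lt) = cong suc (sw-far m k u lt)

  sw-braid : ∀ m u → sw m (sw (suc m) (sw m u)) ≡ sw (suc m) (sw m (sw (suc m) u))
  sw-braid zero zero = refl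
  sw-braid zero (suc zero) = refl
  sw-braid zero (suc (suc zero)) = refl
  sw-braid zero (suc (suc (suc u))) = refl
  sw-braid (suc m) zero = refl
  sw-braid (suc m) (suc u) = cong suc (sw-braid m u)

  Σ-sw : ∀ n m (f : ℕ → ℕ) → suc m < n → Σ< n (λ u → f (sw m u)) ≡ Σ< n f
  Σ-sw zero m f ()
  Σ-sw (suc n) m f (s≤s lt) with m≤n⇒m<n∨m≡n lt
  ... | inj₁ sm<n = cong₂ _+_ (Σ-sw n m f sm<n) (cong f (sw-gt m n sm<n))
  ... | inj₂ refl = begin
      Σ< m (λ u → f (sw m u)) + f (sw m m) + f (sw m (suc m))
        ≡⟨ cong₂ (λ a b → a + b + f (sw m (suc m))) (Σ-ext m (λ u u<m → cong f (sw-lt m u u<m))) (cong f (sw-m m)) ⟩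
      Σ< m f + f (suc m) + f (sw m (suc m))
        ≡⟨ cong (λ x → Σ< m f + f (suc m) + f x) (sw-sm m) ⟩
      Σ< m f + f (suc m) + f m
        ≡⟨ +-assoc (Σ< m f) _ _ ⟩
      Σ< m f + (f (suc m) + f m)
        ≡⟨ cong (Σ< m f +_) (+-comm (f (suc m)) (f m)) ⟩
      Σ< m f + (f m + f (suc m))
        ≡⟨ sym (+-assoc (Σ< m f) _ _) ⟩
      Σ< m f + f m + f (suc m) ∎
    where open ≡-Reasoning

  ΣΣ : ℕ → (ℕ → ℕ → ℕ) → ℕ
  ΣΣ n F = Σ< n (λ u → Σ< n (λ v → F u v))

  ΣΣ-sw : ∀ n m (F : ℕ → ℕ → ℕ) → suc m < n → ΣΣ n (λ u v → F (sw m u) (sw m v)) ≡ ΣΣ n F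
  ΣΣ-sw n m F lt = trans (Σ-ext n (λ u _ → Σ-sw n m (F (sw m u)) lt)) (Σ-sw n m (λ u → Σ< n (F u)) lt)

  ΣΣ-mono : ∀ n {F G : ℕ → ℕ → ℕ} → (∀ u v → F u v ≤ G u v) → ΣΣ n F ≤ ΣΣ n G
  ΣΣ-mono n h = Σ-mono n (λ u _ → Σ-mono n (λ v _ → h u v))

  ΣΣ-ext : ∀ n {F G : ℕ → ℕ → ℕ} → (∀ u v → F u v ≡ G u v) → ΣΣ n F ≡ ΣΣ n G
  ΣΣ-ext n h = Σ-ext n (λ u _ → Σ-ext n (λ v _ → h u v))

  ΣΣ-+ : ∀ n (F G : ℕ → ℕ → ℕ) → ΣΣ n (λ u v → F u v + G u v) ≡ ΣΣ n F + ΣΣ n G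
  ΣΣ-+ n F G = trans (Σ-ext n (λ u _ → Σ-+ n (F u) (G u))) (Σ-+ n _ _)

  Σ-comm : ∀ a b (F : ℕ → ℕ → ℕ) → Σ< a (λ u → Σ< b (λ v → F u v)) ≡ Σ< b (λ v → Σ< a (λ u → F u v))
  Σ-comm zero b F = sym (Σ-zero b (λ _ _ → refl))
  Σ-comm (suc a) b F = trans (cong (_+ Σ< b (F a)) (Σ-comm a b F)) (sym (Σ-+ b (λ v → Σ< a (λ u → F u v)) (F a)))

  ΣΣ-point : ∀ n k l (F : ℕ → ℕ → ℕ) → (∀ u v → (u ≡ k × v ≡ l → ⊥) → F u v ≡ 0) → ΣΣ n F ≤ F k l
  ΣΣ-point n k l F h = ≤-trans (Σ-point n k (λ u → Σ< n (F u)) (λ u u≢k → Σ-zero n (λ v _ → h u v (λ p → u≢k (proj₁ p)))))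
                                (Σ-point n l (F k) (λ v v≢l → h k v (λ p → v≢l (proj₂ p))))

  -- tN k is the word of t_{k+1} = s_k ⋯ s_1 s_0 s_1 ⋯ s_k as a list of letter indices.
  tN : ℕ → List ℕ
  tN zero = 0 ∷ []
  tN (suc k) = suc k ∷ (tN k ++ suc k ∷ [])


module WordCongruence (r n : ℕ) where

  open import Data.Nat hiding (_≟_)
  open import Data.Bool using (not)
  open import Data.Bool.Properties using (not-involutive)
  open import Data.Fin using (Fin; toℕ; inject₁) renaming (zero to fz; suc to fs)
  open import Data.Fin.Properties using (toℕ-inject₁)
  open import Data.List using ([]; _∷_; _++_; map; [_])
  open import Data.List.Properties using (++-assoc; ++-identityʳ; unfold-reverse; map-++; map-∘; map-cong)
  open import Data.Product using (_,_)
  open import Relation.Binary.PropositionalEquality hiding ([_])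
  open Counting using (tN)
  open import Defs
  open G r n

  infixr 2 _≈⟨_⟩_
  infix 3 _∎≈
  _≈⟨_⟩_ : ∀ x {y z} → x ≈G y → y ≈G z → x ≈G z
  x ≈⟨ p ⟩ q = ≈trans p q
  _∎≈ : ∀ x → x ≈G x
  x ∎≈ = ≈refl

  ≡→≈ : ∀ {x y} → x ≡ y → x ≈G y
  ≡→≈ refl = ≈refl

  cong≈ : ∀ x y {u v} → u ≈G v → (x ++ u ++ y) ≈G (x ++ v ++ y)
  cong≈ x y (step x' u v y' b) = subst₂ _≈G_ (lem u) (lem v) (step (x ++ x') u v (y' ++ y) b)
    where
    lem : ∀ w → (x ++ x') ++ w ++ y' ++ y ≡ x ++ (x' ++ w ++ y') ++ y
    lem w = begin
      (x ++ x') ++ w ++ y' ++ y ≡⟨ ++-assoc x x' _ ⟩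
      x ++ x' ++ w ++ y' ++ y ≡⟨ cong (λ z → x ++ x' ++ z) (sym (++-assoc w y' y)) ⟩
      x ++ x' ++ (w ++ y') ++ y ≡⟨ cong (x ++_) (sym (++-assoc x' (w ++ y') y)) ⟩
      x ++ (x' ++ w ++ y') ++ y ∎
      where open ≡-Reasoning
  cong≈ x y ≈refl = ≈refl
  cong≈ x y (≈sym h) = ≈sym (cong≈ x y h)
  cong≈ x y (≈trans h h') = ≈trans (cong≈ x y h) (cong≈ x y h')

  congˡ : ∀ x {u v} → u ≈G v → (x ++ u) ≈G (x ++ v)
  congˡ x {u} {v} h = subst₂ _≈G_ (cong (x ++_) (++-identityʳ u)) (cong (x ++_) (++-identityʳ v)) (cong≈ x [] h)

  congʳ : ∀ y {u v} → u ≈G v → (u ++ y) ≈G (v ++ y)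
  congʳ y h = cong≈ [] y h

  base≈ : ∀ {u v} → Base u v → u ≈G v
  base≈ {u} {v} b = subst₂ _≈G_ (++-identityʳ u) (++-identityʳ v) (step [] u v [] b)

  map-toℕ-tword : ∀ {m} (j : Fin m) → map toℕ (tword j) ≡ tN (toℕ j)
  map-toℕ-tword fz = refl
  map-toℕ-tword (fs i) = cong (suc (toℕ i) ∷_) (begin
    map toℕ (map inject₁ (tword i) ++ fs i ∷ [])
      ≡⟨ map-++ toℕ (map inject₁ (tword i)) _ ⟩
    map toℕ (map inject₁ (tword i)) ++ suc (toℕ i) ∷ []
      ≡⟨ cong (_++ suc (toℕ i) ∷ []) (sym (map-∘ (tword i))) ⟩
    map (λ z → toℕ (inject₁ z)) (tword i) ++ suc (toℕ i) ∷ []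
      ≡⟨ cong (_++ suc (toℕ i) ∷ []) (map-cong toℕ-inject₁ (tword i)) ⟩
    map toℕ (tword i) ++ suc (toℕ i) ∷ []
      ≡⟨ cong (_++ suc (toℕ i) ∷ []) (map-toℕ-tword i) ⟩
    tN (toℕ i) ++ suc (toℕ i) ∷ [] ∎)
    where open ≡-Reasoning

  cancel-r : ∀ w → (w ++ invW w) ≈G []
  cancel-r [] = ≈refl
  cancel-r ((i , b) ∷ w) =
    ((i , b) ∷ w ++ invW ((i , b) ∷ w))
      ≈⟨ ≡→≈ (cong (λ z → (i , b) ∷ w ++ z) (unfold-reverse (i , not b) (map flipL w))) ⟩
    ((i , b) ∷ w ++ (invW w ++ [ (i , not b) ]))
      ≈⟨ ≡→≈ (cong ((i , b) ∷_) (sym (++-assoc w (invW w) _))) ⟩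
    ([ (i , b) ] ++ (w ++ invW w) ++ [ (i , not b) ])
      ≈⟨ cong≈ [ (i , b) ] [ (i , not b) ] (cancel-r w) ⟩
    ((i , b) ∷ (i , not b) ∷ [])
      ≈⟨ base≈ (inv i b) ⟩
    [] ∎≈

  cancel-l : ∀ w → (invW w ++ w) ≈G []
  cancel-l [] = ≈refl
  cancel-l ((i , b) ∷ w) =
    (invW ((i , b) ∷ w) ++ (i , b) ∷ w)
      ≈⟨ ≡→≈ (cong (_++ (i , b) ∷ w) (unfold-reverse (i , not b) (map flipL w))) ⟩
    ((invW w ++ [ (i , not b) ]) ++ (i , b) ∷ w)
      ≈⟨ ≡→≈ (++-assoc (invW w) _ _) ⟩
    (invW w ++ ((i , not b) ∷ (i , b) ∷ []) ++ w)
      ≈⟨ cong≈ (invW w) w (base≈ (subst (λ c → Base ((i , not b) ∷ (i , c) ∷ []) []) (not-involutive b) (inv i (not b)))) ⟩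
    (invW w ++ [] ++ w)
      ≈⟨ cancel-l w ⟩
    [] ∎≈


-- A homomorphic image of G_{r,n} in coloured permutations of ℕ (the wreath
-- product ℤ/r ≀ S_∞): s_0 colours position 0 and s_{m+1} swaps m and m + 1.
module Model (r0 n : ℕ) where

  open import Data.Nat
  open import Data.Nat.Properties
  open import Data.Nat.DivMod
  open import Data.Bool using (Bool; true; false; not)
  open import Data.Fin using (Fin; toℕ)
  open import Data.List using (List; []; _∷_; _++_; map; replicate)
  open import Data.Product using (_,_)
  open import Relation.Binary.PropositionalEquality hiding ([_]; _≗_)
  open Counting
  open import Defs
  open G (suc (suc r0)) n
  open WordCongruence (suc (suc r0)) n using (map-toℕ-tword)

  r : ℕ
  r = suc (suc r0)

  -- Coloured permutations of ℕ: x acts on positions by q x and carries the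
  -- colour d x u (read modulo r) at position u.  Only the first n positions
  -- are ever moved or coloured by the generators.
  record M : Set where
    constructor mk
    field
      q : ℕ → ℕ
      d : ℕ → ℕ
  open M public

  infixl 7 _·_
  _·_ : M → M → M
  x · y = mk (λ u → q x (q y u)) (λ u → d x (q y u) + d y u)

  e : M
  e = mk (λ u → u) (λ _ → 0)

  infix 4 _≗_
  record _≗_ (x y : M) : Set where
    constructor _,_
    field
      eqq : ∀ u → q x u ≡ q y u
      eqd : ∀ u → d x u % r ≡ d y u % r
  open _≗_ public

  ≗-refl : ∀ {x} → x ≗ x
  ≗-refl = (λ _ → refl) , (λ _ → refl)

  ≗-sym : ∀ {x y} → x ≗ y → y ≗ x
  ≗-sym (a , b) = (λ u → sym (a u)) , (λ u → sym (b u))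

  ≗-trans : ∀ {x y z} → x ≗ y → y ≗ z → x ≗ z
  ≗-trans (a , b) (a' , b') = (λ u → trans (a u) (a' u)) , (λ u → trans (b u) (b' u))

  %-cong-+ : ∀ a b a' b' → a % r ≡ a' % r → b % r ≡ b' % r → (a + b) % r ≡ (a' + b') % r
  %-cong-+ a b a' b' p p' = begin
    (a + b) % r ≡⟨ %-distribˡ-+ a b r ⟩
    (a % r + b % r) % r ≡⟨ cong₂ (λ x y → (x + y) % r) p p' ⟩
    (a' % r + b' % r) % r ≡⟨ sym (%-distribˡ-+ a' b' r) ⟩
    (a' + b') % r ∎
    where open ≡-Reasoning

  ·-cong : ∀ {x x' y y'} → x ≗ x' → y ≗ y' → x · y ≗ x' · y'
  ·-cong {x} {x'} {y} {y'} (xq , xd) (yq , yd) =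
    (λ u → trans (cong (q x) (yq u)) (xq (q y' u))) ,
    (λ u → %-cong-+ (d x (q y u)) (d y u) (d x' (q y' u)) (d y' u) (trans (cong (λ z → d x z % r) (yq u)) (xd (q y' u))) (yd u))

  ·-assoc : ∀ x y z → (x · y) · z ≗ x · (y · z)
  ·-assoc x y z = (λ u → refl) , (λ u → cong (_% r) (+-assoc (d x (q y (q z u))) (d y (q z u)) (d z u)))

  e-· : ∀ x → e · x ≗ x
  e-· x = (λ u → refl) , (λ u → refl)

  ·-e : ∀ x → x · e ≗ x
  ·-e x = (λ u → refl) , (λ u → cong (_% r) (+-identityʳ (d x u)))

  -- s_0 (or its inverse) adds colour ±1 at position 0; s_{m+1} acts by sw m.
  δ0 : ℕ → Bool → ℕ
  δ0 zero true = 1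
  δ0 zero false = suc r0
  δ0 (suc _) _ = 0

  genM : ℕ → Bool → M
  genM zero b = mk (λ u → u) (λ u → δ0 u b)
  genM (suc m) b = mk (sw m) (λ _ → 0)

  evL : Letter → M
  evL (i , b) = genM (toℕ i) b

  ev : Word → M
  ev [] = e
  ev (l ∷ w) = evL l · ev w

  ev-++ : ∀ u w → ev (u ++ w) ≗ ev u · ev w
  ev-++ [] w = ≗-sym (e-· (ev w))
  ev-++ (l ∷ u) w = ≗-trans (·-cong (≗-refl {evL l}) (ev-++ u w)) (≗-sym (·-assoc (evL l) (ev u) (ev w)))

  r%r : r % r ≡ 0
  r%r = n%n≡0 r

  evRep0 : ∀ (i : Fin n) k → toℕ i ≡ 0 → ev (replicate k (gen i)) ≗ mk (λ u → u) (λ u → δ0 u true * k)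
  evRep0 i zero p = (λ u → refl) , (λ u → cong (_% r) (sym (*-zeroʳ (δ0 u true))))
  evRep0 i (suc k) p with evRep0 i k p
  ... | (hq , hd) rewrite p = (λ u → hq u) , (λ u → lem u (hd u))
    where
    lem : ∀ u → d (ev (replicate k (gen i))) u % r ≡ (δ0 u true * k) % r →
          (δ0 (q (ev (replicate k (gen i))) u) true + d (ev (replicate k (gen i))) u) % r ≡ (δ0 u true * suc k) % r
    lem u h rewrite hq u = trans (%-cong-+ (δ0 u true) (d (ev (replicate k (gen i))) u) (δ0 u true) (δ0 u true * k) refl h) (cong (_% r) (sym (*-suc (δ0 u true) k)))

  sound-base : ∀ {u v} → Base u v → ev u ≗ ev v
  sound-base (inv i b) with toℕ i
  ... | zero = (λ u → refl) , λ u → lem u b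
    where
    lem : ∀ u b → (δ0 u b + (δ0 u (not b) + 0)) % r ≡ 0 % r
    lem zero true = trans (cong (λ z → (1 + z) % r) (+-identityʳ (suc r0))) r%r
    lem zero false = trans (cong (_% r) (+-comm (suc r0) 1)) r%r
    lem (suc u) b = refl
  ... | suc m = (λ u → sw-inv m u) , (λ u → refl)
  sound-base (ord0 i p) with evRep0 i r p
  ... | (hq , hd) = (λ u → hq u) , (λ u → trans (hd u) (lem u))
    where
    lem : ∀ u → (δ0 u true * r) % r ≡ 0 % r
    lem zero = trans (cong (_% r) (*-identityˡ r)) r%r
    lem (suc u) = refl
  sound-base (ordI i p) with toℕ i
  sound-base (ordI i ()) | zero
  ... | suc m = (λ u → sw-inv m u) , (λ u → refl)
  sound-base (rel01 i j p p') rewrite p | p' =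
    (λ u → trans (sw-inv 0 u) (sym (sw-inv 0 u))) ,
    (λ u → cong (_% r) (lem u))
    where
    lem : ∀ u → δ0 (sw 0 (sw 0 u)) true + (0 + (δ0 (sw 0 u) true + (0 + 0))) ≡
                0 + (δ0 (sw 0 u) true + (0 + (δ0 u true + 0)))
    lem u rewrite sw-inv 0 u | +-identityʳ (δ0 u true) | +-identityʳ (δ0 (sw 0 u) true) = +-comm (δ0 u true) (δ0 (sw 0 u) true)
  sound-base (comm i j lt) with toℕ i | toℕ j
  sound-base (comm i j ()) | _ | zero
  sound-base (comm i j (s≤s ())) | zero | suc zero
  sound-base (comm i j (s≤s (s≤s lt))) | zero | suc (suc mj) = (λ u → refl) , (λ u → cong (_% r) (lem u))
    where
    lem : ∀ u → δ0 (sw (suc mj) u) true + (0 + 0) ≡ 0 + (δ0 u true + 0)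
    lem zero = refl
    lem (suc u) = refl
  sound-base (comm i j (s≤s lt)) | suc mi | suc mj = (λ u → sw-far mi mj u lt) , (λ u → refl)
  sound-base (braid i j p p') with toℕ i | toℕ j
  sound-base (braid i j () p') | zero | _
  ... | suc m | mj rewrite p' = (λ u → sw-braid m u) , (λ u → refl)

  sound-cong : ∀ x u v y → ev u ≗ ev v → ev (x ++ u ++ y) ≗ ev (x ++ v ++ y)
  sound-cong x u v y h =
    ≗-trans (ev-++ x (u ++ y)) (≗-trans (·-cong (≗-refl {ev x}) (≗-trans (ev-++ u y) (≗-trans (·-cong h (≗-refl {ev y})) (≗-sym (ev-++ v y)))))
      (≗-sym (ev-++ x (v ++ y))))

  sound : ∀ {u v} → u ≈G v → ev u ≗ ev v
  sound (step x u v y b) = sound-cong x u v y (sound-base b)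
  sound ≈refl = ≗-refl
  sound (≈sym h) = ≗-sym (sound h)
  sound (≈trans h h') = ≗-trans (sound h) (sound h')

  sM : ℕ → M
  sM m = mk (sw m) (λ _ → 0)

  tM : ℕ → M
  tM k = mk (λ u → u) (λ u → ⟦ u ≟ k ⟧)

  evN : List ℕ → M
  evN [] = e
  evN (k ∷ ks) = genM k true · evN ks

  ev-map-gen : ∀ (w : List (Fin n)) → ev (map gen w) ≡ evN (map toℕ w)
  ev-map-gen [] = refl
  ev-map-gen (x ∷ w) = cong (genM (toℕ x) true ·_) (ev-map-gen w)

  evN-++ : ∀ a b → evN (a ++ b) ≗ evN a · evN b
  evN-++ [] b = ≗-sym (e-· (evN b))
  evN-++ (k ∷ a) b = ≗-trans (·-cong (≗-refl {genM k true}) (evN-++ a b)) (≗-sym (·-assoc (genM k true) (evN a) (evN b)))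

  evN-tN : ∀ k → evN (tN k) ≗ tM k
  evN-tN zero = (λ u → refl) , lem
    where
    lem : ∀ u → (δ0 u true + 0) % r ≡ ⟦ u ≟ 0 ⟧ % r
    lem zero = refl
    lem (suc u) = refl
  evN-tN (suc k) = ≗-trans (·-cong (≗-refl {genM (suc k) true}) (≗-trans (evN-++ (tN k) (suc k ∷ [])) (·-cong (evN-tN k) ≗-refl)))
                           ((λ u → sw-inv k u) , λ u → cong (_% r) (lem u))
    where
    lem : ∀ u → 0 + (⟦ sw k u ≟ k ⟧ + (0 + 0)) ≡ ⟦ u ≟ suc k ⟧
    lem u = trans (+-identityʳ _) (⟦⟧-cong (sw k u ≟ k) (u ≟ suc k)
              (λ p → trans (sym (sw-inv k u)) (trans (cong (sw k) p) (sw-m k)))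
              (λ p → trans (cong (sw k) p) (sw-sm k)))

  ev-tE : ∀ (j : Fin n) → ev (piWord (tE j)) ≗ tM (toℕ j)
  ev-tE j = subst (λ z → z ≗ tM (toℕ j)) (sym (trans (ev-map-gen (tword j)) (cong evN (map-toℕ-tword j))))
                  (evN-tN (toℕ j))

  ev-sE : ∀ (j : Fin n) m → toℕ j ≡ suc m → ev (gen j ∷ []) ≗ sM m
  ev-sE j m p rewrite p = (λ u → refl) , (λ u → refl)


module Statistic (r0 n : ℕ) (blk : ℕ → ℕ) (V : ℕ → Bool) where

  open import Data.Nat hiding (_≟_)
  open import Data.Nat.Properties
  open import Data.Nat.DivMod
  open import Data.Bool using (true; false) renaming (_≟_ to _≟B_)
  open import Data.Product using (_×_; _,_)
  open import Relation.Nullary using (Dec; yes; no)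
  open import Relation.Nullary.Decidable using (_×-dec_; ¬?)
  open import Data.Sum using (_⊎_; inj₁; inj₂)
  open import Data.Empty using (⊥-elim)
  open import Relation.Binary.PropositionalEquality hiding ([_]; _≗_)
  open Counting
  open Model r0 n

  -- Θ_ν for a signed composition ν, abstracted over the data it uses: blk a is
  -- the ν-block of position a, and V a says that a lies outside the positive
  -- ν-blocks.
  Inv : (ℕ → ℕ) → ℕ → ℕ → Set
  Inv f u v = u < v × f v < f u × blk (f u) ≢ blk (f v)

  Inv? : ∀ f u v → Dec (Inv f u v)
  Inv? f u v = u <? v ×-dec (f v <? f u ×-dec ¬? (blk (f u) ≟ blk (f v)))

  Φ : M → ℕ
  Φ x = ΣΣ n (λ u v → ⟦ Inv? (q x) u v ⟧)

  Col : M → ℕ → Set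
  Col x u = V (q x u) ≡ true × d x u % r ≢ 0

  Col? : ∀ x u → Dec (Col x u)
  Col? x u = (V (q x u) ≟B true) ×-dec ¬? (d x u % r ≟ 0)

  Ψ : M → ℕ
  Ψ x = Σ< n (λ u → ⟦ Col? x u ⟧)

  Θ : M → ℕ
  Θ x = Φ x + Ψ x

  Θ-cong : ∀ {x y} → x ≗ y → Θ x ≡ Θ y
  Θ-cong {x} {y} (hq , hd) = cong₂ _+_
    (ΣΣ-ext n (λ u v → ⟦⟧-cong (Inv? (q x) u v) (Inv? (q y) u v)
       (λ { (a , b , c) → a , subst₂ _<_ (hq v) (hq u) b , subst₂ (λ s t → blk s ≢ blk t) (hq u) (hq v) c })
       (λ { (a , b , c) → a , subst₂ _<_ (sym (hq v)) (sym (hq u)) b , subst₂ (λ s t → blk s ≢ blk t) (sym (hq u)) (sym (hq v)) c })))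
    (Σ-ext n (λ u _ → ⟦⟧-cong (Col? x u) (Col? y u)
       (λ { (a , b) → subst (λ s → V s ≡ true) (hq u) a , subst (_≢ 0) (hd u) b })
       (λ { (a , b) → subst (λ s → V s ≡ true) (sym (hq u)) a , subst (_≢ 0) (sym (hd u)) b })))

  Θ-e : Θ e ≡ 0
  Θ-e = cong₂ _+_ (Σ-zero n (λ u _ → Σ-zero n (λ v _ → ⟦⟧-no (Inv? (λ z → z) u v) (λ { (a , b , _) → <-asym a b }))))
                  (Σ-zero n (λ u _ → ⟦⟧-no (Col? e u) (λ { (_ , b) → b refl })))

  sw-order : ∀ m a b → sw m a < sw m b → a < b ⊎ (a ≡ suc m × b ≡ m)
  sw-order zero zero zero (s≤s ())
  sw-order zero zero (suc zero) ()
  sw-order zero zero (suc (suc b)) h = inj₁ z<s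
  sw-order zero (suc zero) zero h = inj₂ (refl , refl)
  sw-order zero (suc zero) (suc zero) ()
  sw-order zero (suc zero) (suc (suc b)) h = inj₁ (s<s z<s)
  sw-order zero (suc (suc a)) zero (s≤s ())
  sw-order zero (suc (suc a)) (suc zero) ()
  sw-order zero (suc (suc a)) (suc (suc b)) h = inj₁ h
  sw-order (suc m) zero zero ()
  sw-order (suc m) zero (suc b) h = inj₁ z<s
  sw-order (suc m) (suc a) zero ()
  sw-order (suc m) (suc a) (suc b) (s≤s h) with sw-order m a b h
  ... | inj₁ lt = inj₁ (s<s lt)
  ... | inj₂ (p , p') = inj₂ (cong suc p , cong suc p')

  -- Right multiplication by s_{m+1} changes Φ by at most one: it reindexes
  -- the pairs by sw m, which preserves the order of all pairs but (m, m+1).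
  Φ-right-s : ∀ x m → suc m < n → Φ (x · sM m) ≤ Φ x + 1
  Φ-right-s x m lt = begin
      Φ (x · sM m)
        ≡⟨ ΣΣ-ext n (λ u v → ⟦⟧-cong (Inv? (q (x · sM m)) u v) _
              (λ { (a , b , c) → subst₂ _<_ (sym (sw-inv m u)) (sym (sw-inv m v)) a , b , c })
              (λ { (a , b , c) → subst₂ _<_ (sw-inv m u) (sw-inv m v) a , b , c })) ⟩
      ΣΣ n (λ u v → H (sw m u) (sw m v))
        ≡⟨ ΣΣ-sw n m H lt ⟩
      ΣΣ n H
        ≤⟨ ΣΣ-mono n (λ a b → ⟦⟧-mono⊎ _ (Inv? (q x) a b) ((a ≟ suc m) ×-dec (b ≟ m))
              (λ { (o , rest) → Data.Sum.map (λ o' → o' , rest) (λ p → p) (sw-order m a b o) })) ⟩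
      ΣΣ n (λ a b → ⟦ Inv? (q x) a b ⟧ + E a b)
        ≡⟨ ΣΣ-+ n _ E ⟩
      Φ x + ΣΣ n E
        ≤⟨ +-monoʳ-≤ (Φ x) (≤-trans (ΣΣ-point n (suc m) m E (λ a b h → ⟦⟧-no ((a ≟ suc m) ×-dec (b ≟ m)) h))
                                     (⟦⟧≤1 ((suc m ≟ suc m) ×-dec (m ≟ m)))) ⟩
      Φ x + 1 ∎
    where
    open ≤-Reasoning
    H : ℕ → ℕ → ℕ
    H a b = ⟦ (sw m a <? sw m b) ×-dec (q x b <? q x a ×-dec ¬? (blk (q x a) ≟ blk (q x b))) ⟧
    E : ℕ → ℕ → ℕ
    E a b = ⟦ (a ≟ suc m) ×-dec (b ≟ m) ⟧

  -- Right multiplication by s_{m+1} permutes the terms of Ψ.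
  Ψ-right-s : ∀ x m → suc m < n → Ψ (x · sM m) ≡ Ψ x
  Ψ-right-s x m lt = begin
      Ψ (x · sM m)
        ≡⟨ Σ-ext n (λ u _ → ⟦⟧-cong (Col? (x · sM m) u) (Col? x (sw m u))
              (λ { (a , b) → a , subst (λ s → s % r ≢ 0) (+-identityʳ (d x (sw m u))) b })
              (λ { (a , b) → a , subst (λ s → s % r ≢ 0) (sym (+-identityʳ (d x (sw m u)))) b })) ⟩
      Σ< n (λ u → ⟦ Col? x (sw m u) ⟧)
        ≡⟨ Σ-sw n m (λ u → ⟦ Col? x u ⟧) lt ⟩
      Ψ x ∎
    where open ≡-Reasoning

  Θ-right-s : ∀ x m → suc m < n → Θ (x · sM m) ≤ Θ x + 1
  Θ-right-s x m lt = begin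
      Φ (x · sM m) + Ψ (x · sM m)
        ≤⟨ +-mono-≤ (Φ-right-s x m lt) (≤-reflexive (Ψ-right-s x m lt)) ⟩
      Φ x + 1 + Ψ x
        ≡⟨ +-assoc (Φ x) 1 (Ψ x) ⟩
      Φ x + (1 + Ψ x)
        ≡⟨ cong (Φ x +_) (+-comm 1 (Ψ x)) ⟩
      Φ x + (Ψ x + 1)
        ≡⟨ sym (+-assoc (Φ x) (Ψ x) 1) ⟩
      Φ x + Ψ x + 1 ∎
    where open ≤-Reasoning

  -- Right multiplication by t_{k+1} only recolours position k.
  Θ-right-t : ∀ x k → Θ (x · tM k) ≤ Θ x + 1
  Θ-right-t x k = begin
      Φ x + Ψ (x · tM k)
        ≤⟨ +-monoʳ-≤ (Φ x) stepΨ ⟩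
      Φ x + (Ψ x + 1)
        ≡⟨ sym (+-assoc (Φ x) (Ψ x) 1) ⟩
      Φ x + Ψ x + 1 ∎
    where
    open ≤-Reasoning
    stepΨ : Ψ (x · tM k) ≤ Ψ x + 1
    stepΨ = begin
      Ψ (x · tM k)
        ≤⟨ Σ-mono n (λ u _ → ⟦⟧-mono⊎ (Col? (x · tM k) u) (Col? x u) (u ≟ k) (lem u)) ⟩
      Σ< n (λ u → ⟦ Col? x u ⟧ + ⟦ u ≟ k ⟧)
        ≡⟨ Σ-+ n _ _ ⟩
      Ψ x + Σ< n (λ u → ⟦ u ≟ k ⟧)
        ≤⟨ +-monoʳ-≤ (Ψ x) (≤-trans (Σ-point n k (λ u → ⟦ u ≟ k ⟧) (λ u h → ⟦⟧-no (u ≟ k) h)) (⟦⟧≤1 (k ≟ k))) ⟩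
      Ψ x + 1 ∎
      where
      lem : ∀ u → Col (x · tM k) u → Col x u ⊎ u ≡ k
      lem u (a , b) with u ≟ k
      ... | yes p = inj₂ p
      ... | no _ = inj₁ (a , subst (λ s → s % r ≢ 0) (+-identityʳ (d x u)) b)

  -- Left multiplication by s_{m+1} preserves Θ when m and m+1 lie in the same
  -- block and V is invariant under sw m: it permutes the values but no
  -- block-crossing inversion or coloured V-value is created or destroyed.
  Θ-left-s : ∀ m x → blk m ≡ blk (suc m) → (∀ a → V (sw m a) ≡ V a) → Θ (sM m · x) ≡ Θ x
  Θ-left-s m x hb hV = cong₂ _+_
    (ΣΣ-ext n (λ u v → ⟦⟧-cong (Inv? (q (sM m · x)) u v) (Inv? (q x) u v)
       (λ { (a , b , c) → a , fwd (q x u) (q x v) b c , subst₂ (λ s t → s ≢ t) (blk-sw (q x u)) (blk-sw (q x v)) c })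
       (λ { (a , b , c) → a , bwd (q x u) (q x v) b c , subst₂ (λ s t → s ≢ t) (sym (blk-sw (q x u))) (sym (blk-sw (q x v))) c })))
    (Σ-ext n (λ u _ → ⟦⟧-cong (Col? (sM m · x) u) (Col? x u)
       (λ { (a , b) → trans (sym (hV (q x u))) a , b })
       (λ { (a , b) → trans (hV (q x u)) a , b })))
    where
    blk-sw : ∀ a → blk (sw m a) ≡ blk a
    blk-sw a with a ≟ m
    ... | yes refl = trans (cong blk (sw-m m)) (sym hb)
    ... | no a≢m with a ≟ suc m
    ... | yes refl = trans (cong blk (sw-sm m)) hb
    ... | no a≢sm = cong blk (sw-id m a a≢m a≢sm)
    fwd : ∀ a b → sw m b < sw m a → blk (sw m a) ≢ blk (sw m b) → b < a
    fwd a b lt ne with sw-order m b a lt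
    ... | inj₁ o = o
    ... | inj₂ (refl , refl) = ⊥-elim (ne (trans (cong blk (sw-m m)) (trans (sym hb) (sym (cong blk (sw-sm m))))))
    bwd : ∀ a b → b < a → blk a ≢ blk b → sw m b < sw m a
    bwd a b lt ne with sw-order m (sw m b) (sw m a) (subst₂ _<_ (sym (sw-inv m b)) (sym (sw-inv m a)) lt)
    ... | inj₁ o = o
    ... | inj₂ (p , p') = ⊥-elim (ne (trans (sym (blk-sw a)) (trans (cong blk p') (trans hb (trans (sym (cong blk p)) (blk-sw b))))))

  -- Left multiplication by t_{k+1} only recolours the value k, which is
  -- invisible to Θ when k ∉ V.
  Θ-left-t : ∀ k x → V k ≡ false → Θ (tM k · x) ≡ Θ x
  Θ-left-t k x hV = cong (Φ x +_)
    (Σ-ext n (λ u _ → ⟦⟧-cong (Col? (tM k · x) u) (Col? x u) (fwd u) (bwd u)))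
    where
    fwd : ∀ u → Col (tM k · x) u → Col x u
    fwd u (a , b) with q x u ≟ k
    ... | yes p = ⊥-elim (true≢false (trans (sym a) (trans (cong V p) hV)))
    ... | no _ = a , b
    bwd : ∀ u → Col x u → Col (tM k · x) u
    bwd u (a , b) with q x u ≟ k
    ... | yes p = ⊥-elim (true≢false (trans (sym a) (trans (cong V p) hV)))
    ... | no _ = a , b


module LengthBound (r0 n : ℕ) (blk : ℕ → ℕ) (V : ℕ → Bool) where

  open import Data.Nat hiding (_≟_)
  open import Data.Nat.Properties
  open import Data.Bool using (true; false)
  open import Data.Fin using (Fin; toℕ)
  open import Data.Fin.Properties using (toℕ<n)
  open import Data.List using (List; []; _∷_; _++_; concatMap; length)
  open import Data.List.Relation.Unary.All using (All; []; _∷_)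
  open import Data.Product using (_×_; _,_; proj₁; Σ)
  open import Relation.Binary.PropositionalEquality hiding ([_]; _≗_)
  open Counting
  open Model r0 n
  open Statistic r0 n blk V
  open import Defs
  open G (suc (suc r0)) n
  open WordCongruence (suc (suc r0)) n

  Θ-right-Π : ∀ x P → Θ (x · ev (piWord P)) ≤ Θ x + 1
  Θ-right-Π x (tE j) = subst (λ z → z ≤ Θ x + 1) (Θ-cong (·-cong (≗-refl {x}) (≗-sym (ev-tE j)))) (Θ-right-t x (toℕ j))
  Θ-right-Π x (sE j p) = go (toℕ j) refl p
    where
    go : ∀ k → toℕ j ≡ k → 1 ≤ k → Θ (x · ev (piWord (sE j p))) ≤ Θ x + 1
    go (suc m) eq _ = subst (λ z → z ≤ Θ x + 1) (Θ-cong (·-cong (≗-refl {x}) (≗-sym (ev-sE j m eq))))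
                  (Θ-right-s x m (subst (_< n) eq (toℕ<n j)))

  Θ-right-word : ∀ ps x → Θ (x · ev (concatMap piWord ps)) ≤ Θ x + length ps
  Θ-right-word [] x = ≤-reflexive (trans (Θ-cong (·-e x)) (sym (+-identityʳ (Θ x))))
  Θ-right-word (P ∷ ps) x = begin
    Θ (x · ev (piWord P ++ concatMap piWord ps))
      ≡⟨ Θ-cong (≗-trans (·-cong (≗-refl {x}) (ev-++ (piWord P) (concatMap piWord ps))) (≗-sym (·-assoc x (ev (piWord P)) (ev (concatMap piWord ps))))) ⟩
    Θ (x · ev (piWord P) · ev (concatMap piWord ps))
      ≤⟨ Θ-right-word ps (x · ev (piWord P)) ⟩
    Θ (x · ev (piWord P)) + length ps
      ≤⟨ +-monoˡ-≤ (length ps) (Θ-right-Π x P) ⟩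
    Θ x + 1 + length ps
      ≡⟨ +-assoc (Θ x) 1 (length ps) ⟩
    Θ x + suc (length ps) ∎
    where open ≤-Reasoning

  Θ-below-length : ∀ w k → ProdLen w k → Θ (ev w) ≤ k
  Θ-below-length w k (ps , len , eq) = begin
    Θ (ev w) ≡⟨ Θ-cong (≗-trans (≗-sym (sound eq)) (≗-sym (e-· _))) ⟩
    Θ (e · ev (concatMap piWord ps)) ≤⟨ Θ-right-word ps e ⟩
    Θ e + length ps ≡⟨ cong₂ _+_ Θ-e len ⟩
    k ∎
    where open ≤-Reasoning

  module Invariance (Pred : PiElt → Set)
    (hP : ∀ P → Pred P → ∀ x → Θ (ev (piWord P) · x) ≡ Θ x) where

    signed-inv : ∀ pb → Pred (proj₁ pb) → ∀ x → Θ (ev (signedWord pb) · x) ≡ Θ x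
    signed-inv (P , true) h x = hP P h x
    signed-inv (P , false) h x = begin
      Θ (ev (invW w) · x) ≡⟨ sym (hP P h _) ⟩
      Θ (ev w · (ev (invW w) · x)) ≡⟨ Θ-cong (≗-trans (≗-sym (·-assoc (ev w) (ev (invW w)) x)) (·-cong (≗-trans (≗-sym (ev-++ w (invW w))) (sound (cancel-r w))) ≗-refl)) ⟩
      Θ (e · x) ≡⟨ Θ-cong (e-· x) ⟩
      Θ x ∎
      where
      open ≡-Reasoning
      w : Word
      w = piWord P

    list-inv : ∀ ps → All (λ pb → Pred (proj₁ pb)) ps → ∀ x → Θ (ev (concatMap signedWord ps) · x) ≡ Θ x
    list-inv [] [] x = Θ-cong (e-· x)
    list-inv (pb ∷ ps) (h ∷ hs) x = begin
      Θ (ev (signedWord pb ++ concatMap signedWord ps) · x)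
        ≡⟨ Θ-cong (≗-trans (·-cong (ev-++ (signedWord pb) _) ≗-refl) (·-assoc (ev (signedWord pb)) (ev (concatMap signedWord ps)) x)) ⟩
      Θ (ev (signedWord pb) · (ev (concatMap signedWord ps) · x))
        ≡⟨ signed-inv pb h _ ⟩
      Θ (ev (concatMap signedWord ps) · x)
        ≡⟨ list-inv ps hs x ⟩
      Θ x ∎
      where open ≡-Reasoning

    subgroup-inv : ∀ h g → (Σ (List (PiElt × Bool)) λ ps → All (λ pb → Pred (proj₁ pb)) ps × concatMap signedWord ps ≈G h) →
                   Θ (ev (h ++ g)) ≡ Θ (ev g)
    subgroup-inv h g (ps , hs , eq) = trans (Θ-cong (≗-trans (ev-++ h g) (·-cong (≗-sym (sound eq)) ≗-refl))) (list-inv ps hs (ev g))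

  inv-sE : ∀ (j : Fin n) p x m → toℕ j ≡ suc m → blk m ≡ blk (suc m) → (∀ a → V (sw m a) ≡ V a) →
           Θ (ev (piWord (sE j p)) · x) ≡ Θ x
  inv-sE j p x m eq hb hV = trans (Θ-cong (·-cong (ev-sE j m eq) ≗-refl)) (Θ-left-s m x hb hV)

  inv-tE : ∀ (j : Fin n) x → V (toℕ j) ≡ false → Θ (ev (piWord (tE j)) · x) ≡ Θ x
  inv-tE j x hV = trans (Θ-cong (·-cong (ev-tE j) ≗-refl)) (Θ-left-t (toℕ j) x hV)


module Letters (r n' : ℕ) where

  open import Data.Nat hiding (_≟_)
  open import Data.Nat.Properties
  open import Data.Bool using (true)
  open import Data.Fin using (Fin; toℕ) renaming (zero to fz; suc to fs)
  open import Data.List using (List; []; _∷_; _++_; map)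
  open import Data.List.Properties using (++-identityʳ; map-++)
  open import Data.List.Relation.Unary.All using (All; []; _∷_)
  open import Data.Product using (_×_; _,_)
  open import Data.Sum using (_⊎_; inj₁; inj₂)
  open import Relation.Binary.PropositionalEquality hiding ([_])
  open import Defs
  open G r (suc n')
  open WordCongruence r (suc n')

  toF : ∀ {m} → ℕ → Fin (suc m)
  toF {m} zero = fz
  toF {zero} (suc k) = fz
  toF {suc m} (suc k) = fs (toF {m} k)

  toℕ-toF : ∀ {m} k → k ≤ m → toℕ (toF {m} k) ≡ k
  toℕ-toF {m} zero h = refl
  toℕ-toF {suc m} (suc k) (s≤s h) = cong suc (toℕ-toF k h)

  toF-toℕ : ∀ {m} (x : Fin (suc m)) → toF (toℕ x) ≡ x
  toF-toℕ fz = refl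
  toF-toℕ {suc m} (fs x) = cong fs (toF-toℕ x)

  Lt : ℕ → Letter
  Lt k = (toF {n'} k , true)

  Lw : List ℕ → Word
  Lw = map Lt

  infix 4 _∼_
  _∼_ : List ℕ → List ℕ → Set
  xs ∼ ys = Lw xs ≈G Lw ys

  ∼refl : ∀ {xs} → xs ∼ xs
  ∼refl = ≈refl
  ∼sym : ∀ {xs ys} → xs ∼ ys → ys ∼ xs
  ∼sym = ≈sym
  ∼trans : ∀ {xs ys zs} → xs ∼ ys → ys ∼ zs → xs ∼ zs
  ∼trans = ≈trans

  ≡→∼ : ∀ {xs ys} → xs ≡ ys → xs ∼ ys
  ≡→∼ refl = ≈refl

  infixr 2 _∼⟨_⟩_ _≡∼⟨_⟩_
  infix 3 _∎∼
  _∼⟨_⟩_ : ∀ x {y z} → x ∼ y → y ∼ z → x ∼ z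
  x ∼⟨ p ⟩ q = ≈trans p q
  _≡∼⟨_⟩_ : ∀ x {y z} → x ≡ y → y ∼ z → x ∼ z
  x ≡∼⟨ refl ⟩ q = q
  _∎∼ : ∀ x → x ∼ x
  x ∎∼ = ≈refl

  ∼cong : ∀ xs zs {ys ys'} → ys ∼ ys' → (xs ++ ys ++ zs) ∼ (xs ++ ys' ++ zs)
  ∼cong xs zs {ys} {ys'} h = subst₂ _≈G_ (sym (lem ys)) (sym (lem ys')) (cong≈ (Lw xs) (Lw zs) h)
    where
    lem : ∀ w → Lw (xs ++ w ++ zs) ≡ Lw xs ++ Lw w ++ Lw zs
    lem w = trans (map-++ Lt xs (w ++ zs)) (cong (Lw xs ++_) (map-++ Lt w zs))

  ∼congˡ : ∀ xs {ys ys'} → ys ∼ ys' → (xs ++ ys) ∼ (xs ++ ys')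
  ∼congˡ xs {ys} {ys'} h = subst₂ _∼_ (cong (xs ++_) (++-identityʳ ys)) (cong (xs ++_) (++-identityʳ ys')) (∼cong xs [] h)

  ∼congʳ : ∀ zs {ys ys'} → ys ∼ ys' → (ys ++ zs) ∼ (ys' ++ zs)
  ∼congʳ zs h = ∼cong [] zs h

  R-comm : ∀ a b → suc a < b → b ≤ n' → (a ∷ b ∷ []) ∼ (b ∷ a ∷ [])
  R-comm a b lt b≤ = base≈
    (comm (toF a) (toF b) (subst₂ (λ s t → suc s < t) (sym (toℕ-toF a (≤-trans (<⇒≤ (<-trans (n<1+n a) lt)) b≤))) (sym (toℕ-toF b b≤)) lt))

  Far : ℕ → ℕ → Set
  Far a b = suc a < b ⊎ suc b < a

  R-far : ∀ a b → Far a b → a ≤ n' → b ≤ n' → (a ∷ b ∷ []) ∼ (b ∷ a ∷ [])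
  R-far a b (inj₁ lt) a≤ b≤ = R-comm a b lt b≤
  R-far a b (inj₂ lt) a≤ b≤ = ∼sym (R-comm b a lt a≤)

  R-sq : ∀ a → 1 ≤ a → a ≤ n' → (a ∷ a ∷ []) ∼ []
  R-sq a h a≤ = base≈ (ordI (toF a) (subst (1 ≤_) (sym (toℕ-toF a a≤)) h))

  R-braid : ∀ a → 1 ≤ a → suc a ≤ n' → (a ∷ suc a ∷ a ∷ []) ∼ (suc a ∷ a ∷ suc a ∷ [])
  R-braid a h a≤ = base≈ (braid (toF a) (toF (suc a)) (subst (1 ≤_) (sym (toℕ-toF a (≤-trans (n≤1+n a) a≤))) h)
    (trans (toℕ-toF (suc a) a≤) (cong suc (sym (toℕ-toF a (≤-trans (n≤1+n a) a≤))))))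

  R-01 : 1 ≤ n' → (0 ∷ 1 ∷ 0 ∷ 1 ∷ []) ∼ (1 ∷ 0 ∷ 1 ∷ 0 ∷ [])
  R-01 h = base≈ (rel01 (toF 0) (toF 1) refl (toℕ-toF 1 h))

  comm-word : ∀ a ks → a ≤ n' → All (λ k → Far a k × k ≤ n') ks → (a ∷ ks) ∼ (ks ++ a ∷ [])
  comm-word a [] a≤ [] = ∼refl
  comm-word a (k ∷ ks) a≤ ((f , k≤) ∷ hs) =
    (a ∷ k ∷ ks) ∼⟨ ∼congʳ ks (R-far a k f a≤ k≤) ⟩
    (k ∷ a ∷ ks) ∼⟨ ∼congˡ (k ∷ []) (comm-word a ks a≤ hs) ⟩
    (k ∷ ks ++ a ∷ []) ∎∼

  comm-word' : ∀ a ks → a ≤ n' → All (λ k → Far a k × k ≤ n') ks → (ks ++ a ∷ []) ∼ (a ∷ ks)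
  comm-word' a ks a≤ hs = ∼sym (comm-word a ks a≤ hs)


module PiWords (r n' : ℕ) where

  open import Data.Nat hiding (_≟_)
  open import Data.Nat.Properties
  open import Data.Bool using (true)
  open import Data.Fin using (Fin; toℕ) renaming (zero to fz; suc to fs)
  open import Data.List using (List; []; _∷_; _++_; map; concatMap; length)
  open import Data.List.Properties using (++-assoc; map-++; map-∘; map-cong; length-map; length-++)
  open import Data.List.Relation.Unary.All using (All; []; _∷_)
  open import Data.Product using (_×_; _,_; Σ)
  open import Relation.Binary.PropositionalEquality
  open Counting using (tN)
  open import Defs
  open G r (suc n')
  open Letters r n'
  open WordCongruence r (suc n') using (map-toℕ-tword)

  -- The elements of Π given by letter index: sE' g is s_g (s_0 = t_1 for
  -- g = 0) and tE' a is t_{a+1}.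
  mkS : Fin (suc n') → PiElt
  mkS fz = tE fz
  mkS (fs x) = sE (fs x) (s≤s z≤n)

  sE' : ℕ → PiElt
  sE' g = mkS (toF g)

  tE' : ℕ → PiElt
  tE' a = tE (toF a)

  pw-sE' : ∀ g → piWord (sE' g) ≡ Lw (g ∷ [])
  pw-sE' g with toF {n'} g
  ... | fz = refl
  ... | fs x = refl

  pw-tE' : ∀ a → a ≤ n' → piWord (tE' a) ≡ Lw (tN a)
  pw-tE' a a≤ = begin
    map gen (tword (toF a))
      ≡⟨ map-cong (λ x → cong (λ y → (y , true)) (sym (toF-toℕ x))) (tword (toF a)) ⟩
    map (λ x → (toF (toℕ x) , true)) (tword (toF a))
      ≡⟨ map-∘ (tword (toF a)) ⟩
    Lw (map toℕ (tword (toF a)))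
      ≡⟨ cong Lw (map-toℕ-tword (toF a)) ⟩
    Lw (tN (toℕ (toF {n'} a)))
      ≡⟨ cong (λ z → Lw (tN z)) (toℕ-toF a a≤) ⟩
    Lw (tN a) ∎
    where open ≡-Reasoning

  wordP : List PiElt → Word
  wordP ps = concatMap piWord ps

  wordP-++ : ∀ ps qs → wordP (ps ++ qs) ≡ wordP ps ++ wordP qs
  wordP-++ [] qs = refl
  wordP-++ (p ∷ ps) qs = trans (cong (piWord p ++_) (wordP-++ ps qs)) (sym (++-assoc (piWord p) _ _))

  word-T : ∀ ts → All (_≤ n') ts → wordP (map tE' ts) ≡ Lw (concatMap tN ts)
  word-T [] [] = refl
  word-T (a ∷ ts) (h ∷ hs) = trans (cong₂ _++_ (pw-tE' a h) (word-T ts hs)) (sym (map-++ Lt (tN a) (concatMap tN ts)))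

  word-S : ∀ gs → wordP (map sE' gs) ≡ Lw gs
  word-S [] = refl
  word-S (g ∷ gs) = cong₂ _++_ (pw-sE' g) (word-S gs)

  word-TS : ∀ ts gs → All (_≤ n') ts → wordP (map tE' ts ++ map sE' gs) ≡ Lw (concatMap tN ts ++ gs)
  word-TS ts gs hs = trans (wordP-++ (map tE' ts) (map sE' gs)) (trans (cong₂ _++_ (word-T ts hs) (word-S gs)) (sym (map-++ Lt (concatMap tN ts) gs)))

  len-TS : ∀ ts gs → length (map tE' ts ++ map sE' gs) ≡ length ts + length gs
  len-TS ts gs = trans (length-++ (map tE' ts)) (cong₂ _+_ (length-map tE' ts) (length-map sE' gs))

  PiDescent : List PiElt → PiElt → Set
  PiDescent xs P = Σ (List PiElt) λ ys → length xs ≡ suc (length ys) × (wordP xs ≈G wordP (P ∷ ys))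


module SwapST (r n' : ℕ) where

  open import Data.Nat hiding (_≟_)
  open import Data.Nat.Properties
  open import Data.List using ([]; _∷_; _++_; map)
  open import Data.List.Properties using (++-assoc; ++-identityʳ)
  open import Data.List.Relation.Unary.All using (All; []; _∷_)
  import Data.List.Relation.Unary.All as All
  import Data.List.Relation.Unary.All.Properties as AllP
  open import Data.Product using (_×_; _,_)
  open import Data.Sum using (inj₁; inj₂)
  open import Relation.Binary.PropositionalEquality hiding ([_])
  open import Relation.Binary.Definitions using (tri<; tri≈; tri>)
  open Counting using (tN; sw; sw-lt; sw-m; sw-sm; sw-gt)
  open Letters r n'

  tN-bound : ∀ a → All (λ k → k ≤ a) (tN a)
  tN-bound zero = z≤n ∷ []
  tN-bound (suc a) = ≤-refl ∷ AllP.++⁺ (All.map (λ h → ≤-trans h (n≤1+n a)) (tN-bound a)) (≤-refl ∷ [])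

  farT : ∀ j a → suc (suc a) ≤ j → j ≤ n' → All (λ k → Far j k × k ≤ n') (tN a)
  farT j a lt j≤ = All.map (λ {k} h → inj₂ (≤-<-trans (s≤s h) lt) , ≤-trans h (≤-trans (≤-trans (n≤1+n a) (n≤1+n (suc a))) (≤-trans lt j≤))) (tN-bound a)

  square-mid : ∀ xs ys a → 1 ≤ a → a ≤ n' → (xs ++ a ∷ a ∷ ys) ∼ (xs ++ ys)
  square-mid xs ys a h a≤ = ∼cong xs ys (R-sq a h a≤)

  s-t-commute : ∀ j a → 1 ≤ j → suc j ≤ a → a ≤ n' → (j ∷ tN a) ∼ (tN a ++ j ∷ [])
  s-t-commute j (suc a') h1 (s≤s ja) a≤ with m≤n⇒m<n∨m≡n ja
  ... | inj₁ j<a' =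
    (j ∷ suc a' ∷ tN a' ++ suc a' ∷ [])
      ∼⟨ ∼congʳ (tN a' ++ suc a' ∷ []) (R-far j (suc a') (inj₁ (s≤s j<a')) (≤-trans ja (≤-trans (n≤1+n a') a≤)) a≤) ⟩
    (suc a' ∷ j ∷ tN a' ++ suc a' ∷ [])
      ∼⟨ ∼cong (suc a' ∷ []) (suc a' ∷ []) (s-t-commute j a' h1 j<a' (≤-trans (n≤1+n a') a≤)) ⟩
    (suc a' ∷ (tN a' ++ j ∷ []) ++ suc a' ∷ [])
      ≡∼⟨ cong (suc a' ∷_) (++-assoc (tN a') (j ∷ []) (suc a' ∷ [])) ⟩
    (suc a' ∷ tN a' ++ j ∷ suc a' ∷ [])
      ∼⟨ ∼cong (suc a' ∷ tN a') [] (R-far j (suc a') (inj₁ (s≤s j<a')) (≤-trans ja (≤-trans (n≤1+n a') a≤)) a≤) ⟩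
    (suc a' ∷ tN a' ++ suc a' ∷ j ∷ [] ++ [])
      ≡∼⟨ cong (suc a' ∷_) (sym (++-assoc (tN a') (suc a' ∷ []) (j ∷ []))) ⟩
    (suc a' ∷ (tN a' ++ suc a' ∷ []) ++ j ∷ []) ∎∼
  s-t-commute (suc j'') (suc .(suc j'')) h1 (s≤s ja) a≤ | inj₂ refl =
    (Ja ∷ Jb ∷ (Ja ∷ tN j'' ++ Ja ∷ []) ++ Jb ∷ [])
      ≡∼⟨ cong (λ z → Ja ∷ Jb ∷ Ja ∷ z) (++-assoc (tN j'') (Ja ∷ []) (Jb ∷ [])) ⟩
    ((Ja ∷ Jb ∷ Ja ∷ []) ++ tN j'' ++ Ja ∷ Jb ∷ [])
      ∼⟨ ∼congʳ (tN j'' ++ Ja ∷ Jb ∷ []) (R-braid Ja h1 a≤) ⟩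
    (Jb ∷ Ja ∷ Jb ∷ tN j'' ++ Ja ∷ Jb ∷ [])
      ∼⟨ ∼cong (Jb ∷ Ja ∷ []) (Ja ∷ Jb ∷ []) (comm-word Jb (tN j'') a≤ (farT Jb j'' (s≤s (s≤s ≤-refl)) a≤)) ⟩
    ((Jb ∷ Ja ∷ []) ++ (tN j'' ++ Jb ∷ []) ++ Ja ∷ Jb ∷ [])
      ≡∼⟨ cong (λ z → Jb ∷ Ja ∷ z) (++-assoc (tN j'') (Jb ∷ []) _) ⟩
    ((Jb ∷ Ja ∷ tN j'') ++ (Jb ∷ Ja ∷ Jb ∷ []) ++ [])
      ∼⟨ ∼cong (Jb ∷ Ja ∷ tN j'') [] (∼sym (R-braid Ja h1 a≤)) ⟩
    ((Jb ∷ Ja ∷ tN j'') ++ (Ja ∷ Jb ∷ Ja ∷ []) ++ [])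
      ≡∼⟨ cong (Jb ∷_) (lem) ⟩
    (Jb ∷ (Ja ∷ tN j'' ++ Ja ∷ []) ++ Jb ∷ []) ++ Ja ∷ [] ∎∼
    where
    Ja : ℕ
    Ja = suc j''
    Jb : ℕ
    Jb = suc (suc j'')
    lem : (Ja ∷ tN j'') ++ (Ja ∷ Jb ∷ Ja ∷ []) ++ [] ≡ ((Ja ∷ tN j'' ++ Ja ∷ []) ++ Jb ∷ []) ++ Ja ∷ []
    lem = cong (Ja ∷_) (begin
      tN j'' ++ (Ja ∷ Jb ∷ Ja ∷ []) ++ []
        ≡⟨ cong (tN j'' ++_) (++-identityʳ _) ⟩
      tN j'' ++ Ja ∷ Jb ∷ Ja ∷ []
        ≡⟨ sym (++-assoc (tN j'') (Ja ∷ []) (Jb ∷ Ja ∷ [])) ⟩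
      (tN j'' ++ Ja ∷ []) ++ Jb ∷ Ja ∷ []
        ≡⟨ sym (++-assoc (tN j'' ++ Ja ∷ []) (Jb ∷ []) (Ja ∷ [])) ⟩
      ((tN j'' ++ Ja ∷ []) ++ Jb ∷ []) ++ Ja ∷ [] ∎)
      where open ≡-Reasoning

  t-s-swap : ∀ j' a → suc j' ≤ n' → a ≤ n' → (tN a ++ suc j' ∷ []) ∼ (suc j' ∷ tN (sw j' a))
  t-s-swap j' a j≤ a≤ with <-cmp a j'
  ... | tri< a<j' _ _ = subst (λ z → (tN a ++ suc j' ∷ []) ∼ (suc j' ∷ tN z)) (sym (sw-lt j' a a<j'))
                          (comm-word' (suc j') (tN a) j≤ (farT (suc j') a (s≤s a<j') j≤))
  ... | tri≈ _ refl _ = subst (λ z → (tN a ++ suc a ∷ []) ∼ (suc a ∷ tN z)) (sym (sw-m a))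
     (∼sym (square-mid [] (tN a ++ suc a ∷ []) (suc a) (s≤s z≤n) j≤))
  ... | tri> _ _ j'<a with m≤n⇒m<n∨m≡n j'<a
  ...   | inj₂ refl = subst (λ z → (tN (suc j') ++ suc j' ∷ []) ∼ (suc j' ∷ tN z)) (sym (sw-sm j'))
     (tN (suc j') ++ suc j' ∷ []
        ≡∼⟨ cong (suc j' ∷_) (++-assoc (tN j') (suc j' ∷ []) (suc j' ∷ [])) ⟩
      (suc j' ∷ tN j') ++ suc j' ∷ suc j' ∷ []
        ∼⟨ square-mid (suc j' ∷ tN j') [] (suc j') (s≤s z≤n) j≤ ⟩
      (suc j' ∷ tN j') ++ []
        ≡∼⟨ ++-identityʳ (suc j' ∷ tN j') ⟩
      suc j' ∷ tN j' ∎∼)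
  ...   | inj₁ sj'<a = subst (λ z → (tN a ++ suc j' ∷ []) ∼ (suc j' ∷ tN z)) (sym (sw-gt j' a sj'<a))
     (∼sym (s-t-commute (suc j') a (s≤s z≤n) sj'<a a≤))


module MoveT (r n' : ℕ) where

  open import Data.Nat hiding (_≟_)
  open import Data.Nat.Properties
  open import Data.List using (List; []; _∷_; _++_; map; concatMap; length)
  open import Data.List.Properties using (++-assoc; ++-identityʳ)
  open import Data.List.Relation.Unary.All using (All; []; _∷_)
  import Data.List.Relation.Unary.All as All
  open import Data.List.Relation.Unary.Any using (Any; here; there)
  open import Data.Product using (_×_; _,_; Σ)
  open import Data.Sum using (inj₁; inj₂)
  open import Relation.Binary.PropositionalEquality hiding ([_])
  open import Relation.Binary.Definitions using (tri<; tri≈; tri>)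
  open import Relation.Nullary using (yes; no)
  open Counting using (tN; sw; sw-m; sw-sm; sw-id)
  open Letters r n'
  open SwapST r n'

  cong₂∼ : ∀ {xs xs' ys ys'} → xs ∼ xs' → ys ∼ ys' → (xs ++ ys) ∼ (xs' ++ ys')
  cong₂∼ {xs} {xs'} {ys} {ys'} h h' = ∼trans (∼congʳ ys h) (∼congˡ xs' h')

  regroup : ∀ (a b c d e : List ℕ) → (a ++ b ++ c) ++ (d ++ e) ≡ (a ++ b) ++ (c ++ d) ++ e
  regroup a b c d e = trans (trans (++-assoc a (b ++ c) (d ++ e)) (cong (a ++_) (++-assoc b c (d ++ e))))
                            (sym (trans (++-assoc a b ((c ++ d) ++ e)) (cong (λ z → a ++ b ++ z) (++-assoc c d e))))

  ungroup : ∀ (a b c d : List ℕ) → (a ++ b) ++ (c ++ d) ≡ a ++ (b ++ c) ++ d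
  ungroup a b c d = trans (++-assoc a b (c ++ d)) (cong (a ++_) (sym (++-assoc b c d)))

  conj-commute : ∀ Y Yi {u v u' v'} → (Yi ++ Y) ∼ [] → (Y ++ u ++ Yi) ∼ u' → (Y ++ v ++ Yi) ∼ v' →
                 (u ++ v) ∼ (v ++ u) → (u' ++ v') ∼ (v' ++ u')
  conj-commute Y Yi {u} {v} {u'} {v'} YiY cu cv uv =
    (u' ++ v')                              ∼⟨ cong₂∼ (∼sym cu) (∼sym cv) ⟩
    ((Y ++ u ++ Yi) ++ (Y ++ v ++ Yi))      ≡∼⟨ regroup Y u Yi Y (v ++ Yi) ⟩
    ((Y ++ u) ++ (Yi ++ Y) ++ (v ++ Yi))    ∼⟨ ∼cong (Y ++ u) (v ++ Yi) YiY ⟩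
    ((Y ++ u) ++ [] ++ (v ++ Yi))           ≡∼⟨ ungroup Y u v Yi ⟩
    (Y ++ (u ++ v) ++ Yi)                   ∼⟨ ∼cong Y Yi uv ⟩
    (Y ++ (v ++ u) ++ Yi)                   ≡∼⟨ sym (ungroup Y v u Yi) ⟩
    ((Y ++ v) ++ [] ++ (u ++ Yi))           ∼⟨ ∼cong (Y ++ v) (u ++ Yi) (∼sym YiY) ⟩
    ((Y ++ v) ++ (Yi ++ Y) ++ (u ++ Yi))    ≡∼⟨ sym (regroup Y v Yi Y (u ++ Yi)) ⟩
    ((Y ++ v ++ Yi) ++ (Y ++ u ++ Yi))      ∼⟨ cong₂∼ cv cu ⟩
    (v' ++ u') ∎∼

  -- The elements t_i pairwise commute: first for adjacent indices, by induction
  -- from the relation s_0 s_1 s_0 s_1 = s_1 s_0 s_1 s_0, since conjugation by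
  -- s_{a+1} s_{a+2} sends t_{a+1}, t_{a+2} to t_{a+2}, t_{a+3} …
  t-commute-adj : ∀ a → suc a ≤ n' → (tN a ++ tN (suc a)) ∼ (tN (suc a) ++ tN a)
  t-commute-adj zero h = R-01 h
  t-commute-adj (suc a'') h =
    conj-commute (A ∷ B ∷ []) (B ∷ A ∷ []) YiY conj-lower conj-upper (t-commute-adj a'' (≤-trans (n≤1+n _) h))
    where
    A : ℕ
    A = suc a''
    B : ℕ
    B = suc A
    A≤ : A ≤ n'
    A≤ = ≤-trans (n≤1+n A) h
    conj-lower : (A ∷ B ∷ tN a'' ++ B ∷ A ∷ []) ∼ tN A
    conj-lower =
      (A ∷ B ∷ tN a'' ++ B ∷ A ∷ [])
        ∼⟨ ∼cong (A ∷ []) (B ∷ A ∷ []) (comm-word B (tN a'') h (farT B a'' ≤-refl h)) ⟩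
      (A ∷ (tN a'' ++ B ∷ []) ++ B ∷ A ∷ [])
        ≡∼⟨ cong (A ∷_) (++-assoc (tN a'') (B ∷ []) _) ⟩
      ((A ∷ tN a'') ++ B ∷ B ∷ A ∷ [])
        ∼⟨ square-mid (A ∷ tN a'') (A ∷ []) B (s≤s z≤n) h ⟩
      tN A ∎∼
    conj-upper : (A ∷ B ∷ tN A ++ B ∷ A ∷ []) ∼ tN B
    conj-upper =
      (A ∷ B ∷ tN A ++ B ∷ A ∷ [])
        ≡∼⟨ cong (λ z → A ∷ B ∷ z) (sym (++-assoc (tN A) (B ∷ []) (A ∷ []))) ⟩
      (A ∷ tN B ++ A ∷ [])
        ∼⟨ ∼congʳ (A ∷ []) (s-t-commute A B (s≤s z≤n) ≤-refl h) ⟩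
      ((tN B ++ A ∷ []) ++ A ∷ [])
        ≡∼⟨ ++-assoc (tN B) (A ∷ []) (A ∷ []) ⟩
      (tN B ++ A ∷ A ∷ [])
        ∼⟨ subst (λ z → (tN B ++ A ∷ A ∷ []) ∼ z) (++-identityʳ (tN B)) (square-mid (tN B) [] A (s≤s z≤n) A≤) ⟩
      tN B ∎∼
    YiY : (B ∷ A ∷ A ∷ B ∷ []) ∼ []
    YiY = ∼trans (square-mid (B ∷ []) (B ∷ []) A (s≤s z≤n) A≤) (R-sq B (s≤s z≤n) h)

  -- … then for all pairs, since t_{b+1} = s_b t_b s_b and s_b commutes with t_{a+1}
  -- for a + 1 < b.
  t-commute-lt : ∀ a b → a < b → b ≤ n' → (tN a ++ tN b) ∼ (tN b ++ tN a)
  t-commute-lt a (suc b') (s≤s a≤b') b≤ with m≤n⇒m<n∨m≡n a≤b'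
  ... | inj₂ refl = t-commute-adj a b≤
  ... | inj₁ a<b' =
    (tN a ++ B ∷ tN b' ++ B ∷ [])
      ≡∼⟨ sym (++-assoc (tN a) (B ∷ []) _) ⟩
    ((tN a ++ B ∷ []) ++ tN b' ++ B ∷ [])
      ∼⟨ ∼congʳ (tN b' ++ B ∷ []) (comm-word' B (tN a) b≤ (farT B a (s≤s a<b') b≤)) ⟩
    (B ∷ tN a ++ tN b' ++ B ∷ [])
      ≡∼⟨ cong (B ∷_) (sym (++-assoc (tN a) (tN b') _)) ⟩
    (B ∷ (tN a ++ tN b') ++ B ∷ [])
      ∼⟨ ∼cong (B ∷ []) (B ∷ []) (t-commute-lt a b' a<b' (≤-trans (n≤1+n b') b≤)) ⟩
    (B ∷ (tN b' ++ tN a) ++ B ∷ [])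
      ≡∼⟨ cong (B ∷_) (++-assoc (tN b') (tN a) _) ⟩
    ((B ∷ tN b') ++ (tN a ++ B ∷ []))
      ∼⟨ ∼congˡ (B ∷ tN b') (comm-word' B (tN a) b≤ (farT B a (s≤s a<b') b≤)) ⟩
    ((B ∷ tN b') ++ (B ∷ tN a))
      ≡∼⟨ cong (B ∷_) (sym (++-assoc (tN b') (B ∷ []) (tN a))) ⟩
    (B ∷ (tN b' ++ B ∷ []) ++ tN a) ∎∼
    where
    B : ℕ
    B = suc b'

  t-commute : ∀ a b → a ≤ n' → b ≤ n' → (tN a ++ tN b) ∼ (tN b ++ tN a)
  t-commute a b a≤ b≤ with <-cmp a b
  ... | tri< lt _ _ = t-commute-lt a b lt b≤
  ... | tri≈ _ refl _ = ∼refl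
  ... | tri> _ _ gt = ∼sym (t-commute-lt b a gt a≤)

  t-to-front : ∀ ts a → All (_≤ n') ts → Any (a ≡_) ts →
           Σ (List ℕ) λ ts' → length ts ≡ suc (length ts') × All (_≤ n') ts' ×
             (concatMap tN ts ∼ (tN a ++ concatMap tN ts'))
  t-to-front (x ∷ ts) a (x≤ ∷ hs) (here refl) = ts , refl , hs , ∼refl
  t-to-front (x ∷ ts) a (x≤ ∷ hs) (there m) with t-to-front ts a hs m
  ... | ts' , len , hs' , eq = x ∷ ts' , cong suc len , x≤ ∷ hs' ,
    ((tN x ++ concatMap tN ts)
      ∼⟨ ∼congˡ (tN x) eq ⟩
    (tN x ++ tN a ++ concatMap tN ts')
      ≡∼⟨ sym (++-assoc (tN x) (tN a) _) ⟩
    ((tN x ++ tN a) ++ concatMap tN ts')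
      ∼⟨ ∼congʳ (concatMap tN ts') (t-commute x a x≤ (All.lookup hs m)) ⟩
    ((tN a ++ tN x) ++ concatMap tN ts')
      ≡∼⟨ ++-assoc (tN a) (tN x) _ ⟩
    (tN a ++ concatMap tN (x ∷ ts')) ∎∼)

  sw-bound : ∀ j' x → suc j' ≤ n' → x ≤ n' → sw j' x ≤ n'
  sw-bound j' x j≤ x≤ with x Data.Nat.≟ j'
  ... | yes refl = subst (_≤ n') (sym (sw-m x)) j≤
  ... | no x≢j with x Data.Nat.≟ suc j'
  ...   | yes refl = subst (_≤ n') (sym (sw-sm j')) (≤-trans (n≤1+n j') j≤)
  ...   | no x≢sj = subst (_≤ n') (sym (sw-id j' x x≢j x≢sj)) x≤

  ts-s-swap : ∀ j' ts → suc j' ≤ n' → All (_≤ n') ts →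
        (concatMap tN ts ++ suc j' ∷ []) ∼ (suc j' ∷ concatMap tN (map (sw j') ts))
  ts-s-swap j' [] j≤ [] = ∼refl
  ts-s-swap j' (x ∷ ts) j≤ (x≤ ∷ hs) =
    ((tN x ++ concatMap tN ts) ++ suc j' ∷ [])
      ≡∼⟨ ++-assoc (tN x) _ _ ⟩
    (tN x ++ concatMap tN ts ++ suc j' ∷ [])
      ∼⟨ ∼congˡ (tN x) (ts-s-swap j' ts j≤ hs) ⟩
    (tN x ++ suc j' ∷ concatMap tN (map (sw j') ts))
      ≡∼⟨ sym (++-assoc (tN x) (suc j' ∷ []) _) ⟩
    ((tN x ++ suc j' ∷ []) ++ concatMap tN (map (sw j') ts))
      ∼⟨ ∼congʳ _ (t-s-swap j' x j≤ x≤) ⟩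
    (suc j' ∷ concatMap tN (map (sw j') (x ∷ ts))) ∎∼


module Runs (c : ℕ → Bool) (c0 : c 0 ≡ false) where

  open import Data.Nat hiding (_≟_)
  open import Data.Nat.Properties
  open import Data.List using (List; []; _∷_; _++_; length)
  open import Data.List.Properties using (length-++)
  open import Data.List.Relation.Unary.All using (All; []; _∷_)
  import Data.List.Relation.Unary.All as All
  import Data.List.Relation.Unary.All.Properties as AllP
  open import Data.Product using (_×_; _,_; proj₁; proj₂; Σ)
  open import Data.Sum using (inj₁; inj₂)
  open import Data.Empty using (⊥; ⊥-elim)
  open import Relation.Binary.PropositionalEquality hiding ([_])
  open Counting using (true≢false)

  -- The combinatorics of a set c of "cuts" (the block boundaries j of μ with
  -- s_j ∉ Π_μ; 0 is never a cut).  Cuts come in runs of consecutive cuts.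
  not-cut-0 : c 0 ≡ true → ⊥
  not-cut-0 h = true≢false (trans (sym h) c0)

  -- dn j is the number of consecutive cuts ending at j (0 if j is not a cut),
  -- and lo j = j - dn j is the position just before that run.
  dnB : Bool → ℕ → ℕ
  dnB true d = suc d
  dnB false d = 0

  dn : ℕ → ℕ
  dn zero = 0
  dn (suc j) = dnB (c (suc j)) (dn j)

  lo : ℕ → ℕ
  lo j = j ∸ dn j

  -- ul j is the word s_{lo j + 1} ⋯ s_j of the run ending at j (empty if j is
  -- not a cut).
  ulB : Bool → List ℕ → ℕ → List ℕ
  ulB true u k = u ++ k ∷ []
  ulB false u k = []

  ul : ℕ → List ℕ
  ul zero = []
  ul (suc j) = ulB (c (suc j)) (ul j) (suc j)

  -- Wl k = ul k ⋯ ul 1: for every run, the longest element of the symmetric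
  -- group on the positions lo j, …, j of that run.  It is the "s-part" of the
  -- test element.
  Wl : ℕ → List ℕ
  Wl zero = []
  Wl (suc k) = ul (suc k) ++ Wl k

  dn≤ : ∀ j → dn j ≤ j
  dn≤ zero = z≤n
  dn≤ (suc j) with c (suc j)
  ... | true = s≤s (dn≤ j)
  ... | false = z≤n

  dn-true : ∀ k → c (suc k) ≡ true → dn (suc k) ≡ suc (dn k)
  dn-true k h rewrite h = refl

  ul-true : ∀ k → c (suc k) ≡ true → ul (suc k) ≡ ul k ++ suc k ∷ []
  ul-true k h rewrite h = refl

  dn-false : ∀ k → c k ≡ false → dn k ≡ 0
  dn-false zero h = refl
  dn-false (suc k) h rewrite h = refl

  ul-false : ∀ k → c k ≡ false → ul k ≡ []
  ul-false zero h = refl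
  ul-false (suc k) h rewrite h = refl

  lo-true : ∀ k → c (suc k) ≡ true → lo (suc k) ≡ lo k
  lo-true k h rewrite dn-true k h = refl

  lo-false : ∀ k → c k ≡ false → lo k ≡ k
  lo-false k h rewrite dn-false k h = refl

  lo≤ : ∀ k → lo k ≤ k
  lo≤ k = m∸n≤m k (dn k)

  lo<  : ∀ k → c k ≡ true → lo k < k
  lo< zero h = ⊥-elim (not-cut-0 h)
  lo< (suc k) h rewrite lo-true k h = s≤s (lo≤ k)

  len-ul : ∀ k → length (ul k) ≡ dn k
  len-ul zero = refl
  len-ul (suc k) with c (suc k)
  ... | true = trans (length-++ (ul k)) (trans (+-comm (length (ul k)) 1) (cong suc (len-ul k)))
  ... | false = refl

  c-lo : ∀ k → c (lo k) ≡ false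
  c-lo zero = c0
  c-lo (suc k) with c (suc k) in eq
  ... | false = eq
  ... | true = c-lo k

  inrun : ∀ k x → c k ≡ true → lo k < x → x ≤ k → c x ≡ true
  inrun zero x h _ _ = ⊥-elim (not-cut-0 h)
  inrun (suc k) x h lt x≤ with m≤n⇒m<n∨m≡n x≤
  ... | inj₂ refl = h
  ... | inj₁ (s≤s x≤k) with c k in eq
  ...   | true = inrun k x eq (subst (_< x) (lo-true k h) lt) x≤k
  ...   | false = ⊥-elim (<-irrefl refl (<-≤-trans (subst (_< x) (trans (lo-true k h) (lo-false k eq)) lt) x≤k))

  ul-head : ∀ k → c k ≡ true → Σ (List ℕ) λ rest → ul k ≡ suc (lo k) ∷ rest
  ul-head zero h = ⊥-elim (not-cut-0 h)
  ul-head (suc k) h with c k in eq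
  ... | true with ul-head k eq
  ...   | rest , p = rest ++ suc k ∷ [] , trans (ul-true k h) (trans (cong (_++ suc k ∷ []) p) (cong (λ z → suc z ∷ rest ++ suc k ∷ []) (sym (lo-true k h))))
  ul-head (suc k) h | false = [] , trans (ul-true k h) (trans (cong (_++ suc k ∷ []) (ul-false k eq)) (cong (λ z → suc z ∷ []) (sym (trans (lo-true k h) (lo-false k eq)))))

  ul-letters : ∀ k → All (λ g → lo k < g × g ≤ k) (ul k)
  ul-letters zero = []
  ul-letters (suc k) with c (suc k) in eq
  ... | false = []
  ... | true = (AllP.++⁺ (All.map (λ (a , b) → a , ≤-trans b (n≤1+n k)) (ul-letters k)) ((s≤s (lo≤ k) , ≤-refl) ∷ []))

  ul-c : ∀ k → All (λ g → c g ≡ true) (ul k)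
  ul-c zero = []
  ul-c (suc k) with c (suc k) in eq
  ... | false = []
  ... | true = All.map (λ {g} ab → inrun (suc k) g eq (proj₁ ab) (proj₂ ab)) (subst (All (λ g → lo (suc k) < g × g ≤ suc k)) (ul-true k eq) (ul-letters (suc k)))

  Wl-letters : ∀ k → All (λ g → c g ≡ true) (Wl k)
  Wl-letters zero = []
  Wl-letters (suc k) = AllP.++⁺ (ul-c (suc k)) (Wl-letters k)


module RunDescents (r n' : ℕ) (c : ℕ → Bool) (c0 : c 0 ≡ false) (cb : ∀ g → c g ≡ true → g ≤ n') where

  open import Data.Nat hiding (_≟_)
  open import Data.Nat.Properties
  open import Data.List using (List; []; _∷_; _++_; length)
  open import Data.List.Properties using (length-++; ++-assoc)
  open import Data.List.Relation.Unary.All using (All; []; _∷_)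
  import Data.List.Relation.Unary.All as All
  open import Data.Product using (_×_; _,_; proj₁; proj₂; Σ)
  open import Data.Sum using (inj₁; inj₂)
  open import Data.Empty using (⊥-elim)
  open import Relation.Binary.PropositionalEquality hiding ([_])
  open import Relation.Binary.Definitions using (Tri; tri<; tri≈; tri>)
  open Counting using (true≢false)
  open Runs c c0
  open Letters r n'

  ul-shift : ∀ k x → c k ≡ true → lo k < x → suc x ≤ k → (ul k ++ x ∷ []) ∼ (suc x ∷ ul k)
  ul-shift zero x h _ _ = ⊥-elim (not-cut-0 h)
  ul-shift (suc k') x h lt (s≤s x≤k') with m≤n⇒m<n∨m≡n x≤k'
  ... | inj₁ x<k' =
    subst (λ z → (z ++ x ∷ []) ∼ (suc x ∷ z)) (sym (ul-true k' h))
    ((ul k' ++ suc k' ∷ []) ++ x ∷ []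
       ≡∼⟨ ++-assoc (ul k') _ _ ⟩
     ul k' ++ suc k' ∷ x ∷ []
       ∼⟨ ∼congˡ (ul k') (R-far (suc k') x (inj₂ (s≤s x<k')) (cb (suc k') h) (≤-trans (≤-trans (n≤1+n x) x<k') (≤-trans (n≤1+n k') (cb (suc k') h)))) ⟩
     ul k' ++ x ∷ suc k' ∷ []
       ≡∼⟨ sym (++-assoc (ul k') _ _) ⟩
     (ul k' ++ x ∷ []) ++ suc k' ∷ []
       ∼⟨ ∼congʳ (suc k' ∷ []) (ul-shift k' x ck' (subst (_< x) (lo-true k' h) lt) x<k') ⟩
     suc x ∷ ul k' ++ suc k' ∷ [] ∎∼)
    where
    ck' : c k' ≡ true
    ck' = inrun (suc k') k' h (<-trans lt x<k') (n≤1+n k')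
  ... | inj₂ refl = go x refl lt
    where
    go : ∀ x' → x' ≡ x → lo (suc x) < x' → (ul (suc x) ++ x' ∷ []) ∼ (suc x' ∷ ul (suc x))
    go zero p lt' = ⊥-elim (<-irrefl refl (<-≤-trans lt' z≤n))
    go (suc k'') refl lt' = subst (λ z → (z ++ K' ∷ []) ∼ (suc K' ∷ z)) (sym (trans (ul-true K' h) (cong (_++ K ∷ []) (ul-true k'' cK'))))
      (((ul k'' ++ K' ∷ []) ++ K ∷ []) ++ K' ∷ []
         ≡∼⟨ to-braid ⟩
       ul k'' ++ (K' ∷ K ∷ K' ∷ []) ++ []
         ∼⟨ ∼cong (ul k'') [] (R-braid K' (s≤s z≤n) (cb K h)) ⟩
       ul k'' ++ (K ∷ K' ∷ K ∷ []) ++ []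
         ≡∼⟨ from-braid ⟩
       (ul k'' ++ K ∷ []) ++ K' ∷ K ∷ []
         ∼⟨ ∼congʳ (K' ∷ K ∷ []) (comm-word' K (ul k'') (cb K h) (All.map (λ {g} ab → inj₂ (s≤s (s≤s (proj₂ ab))) , ≤-trans (proj₂ ab) (≤-trans (n≤1+n k'') (≤-trans (n≤1+n K') (cb K h)))) (ul-letters k''))) ⟩
       K ∷ ul k'' ++ K' ∷ K ∷ []
         ≡∼⟨ cong (K ∷_) (sym (++-assoc (ul k'') (K' ∷ []) (K ∷ []))) ⟩
       K ∷ (ul k'' ++ K' ∷ []) ++ K ∷ [] ∎∼)
      where
      K' : ℕ
      K' = suc k''
      K : ℕ
      K = suc K'
      cK' : c K' ≡ true
      cK' = inrun K K' h lt' (n≤1+n K')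
      to-braid : ((ul k'' ++ K' ∷ []) ++ K ∷ []) ++ K' ∷ [] ≡ ul k'' ++ (K' ∷ K ∷ K' ∷ []) ++ []
      to-braid = trans (++-assoc (ul k'' ++ K' ∷ []) _ _) (++-assoc (ul k'') _ _)
      from-braid : ul k'' ++ (K ∷ K' ∷ K ∷ []) ++ [] ≡ (ul k'' ++ K ∷ []) ++ K' ∷ K ∷ []
      from-braid = sym (++-assoc (ul k'') _ _)

  len-++-suc : ∀ (U W : List ℕ) {W'} → length W ≡ suc (length W') → length (U ++ W) ≡ suc (length (U ++ W'))
  len-++-suc U W {W'} p = trans (length-++ U) (trans (cong (length U +_) p) (trans (+-suc (length U) (length W')) (cong suc (sym (length-++ U)))))

  LeftDescent : List ℕ → ℕ → Set
  LeftDescent w j = Σ (List ℕ) λ w' → length w ≡ suc (length w') × (w ∼ (j ∷ w'))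

  prefix-descent : ∀ U w j j' → LeftDescent w j → (U ++ j ∷ []) ∼ (j' ∷ U) → LeftDescent (U ++ w) j'
  prefix-descent U w j j' (w' , len , eqw) move = U ++ w' , len-++-suc U w len ,
    (U ++ w
       ∼⟨ ∼congˡ U eqw ⟩
     U ++ j ∷ w'
       ≡∼⟨ sym (++-assoc U (j ∷ []) w') ⟩
     (U ++ j ∷ []) ++ w'
       ∼⟨ ∼congʳ w' move ⟩
     j' ∷ U ++ w' ∎∼)

  -- For the run U = ul (suc k)
  -- in front: cuts below the run commute with U, the first cut of the run is
  -- the first letter of U, and a later cut j'+1 of the run arises from the
  -- descent j' of Wl k, shifted by U (ul-shift).
  Wdesc : ∀ k j → c j ≡ true → j ≤ k → LeftDescent (Wl k) j
  Wdesc zero zero h z≤n = ⊥-elim (not-cut-0 h)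
  Wdesc (suc k) j h j≤ = caseB (c (suc k)) refl
    where
    caseB : (b : Bool) → c (suc k) ≡ b → LeftDescent (Wl (suc k)) j
    caseB false eq with m≤n⇒m<n∨m≡n j≤
    ... | inj₂ refl = ⊥-elim (true≢false (trans (sym h) eq))
    ... | inj₁ (s≤s j≤k) = subst (λ z → LeftDescent (z ++ Wl k) j) (sym (ul-false (suc k) eq)) (Wdesc k j h j≤k)
    caseB true eq = main (<-cmp j (suc Lo))
      where
      U : List ℕ
      U = ul (suc k)
      Lo : ℕ
      Lo = lo (suc k)
      Ubound : All (λ g → Lo < g × g ≤ n') U
      Ubound = All.zipWith (λ { ((a , b) , cg) → a , cb _ cg }) (ul-letters (suc k) , ul-c (suc k))
      main : Tri (j < suc Lo) (j ≡ suc Lo) (suc Lo < j) → LeftDescent (U ++ Wl k) j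
      main (tri< j<sLo _ _) with m≤n⇒m<n∨m≡n (≤-pred j<sLo)
      ... | inj₂ refl = ⊥-elim (true≢false (trans (sym h) (c-lo (suc k))))
      ... | inj₁ j<Lo = prefix-descent U (Wl k) j j
              (Wdesc k j h (≤-trans (<⇒≤ j<Lo) (≤-pred (lo< (suc k) eq))))
              (comm-word' j U (cb j h) (All.map (λ ab → inj₁ (<-≤-trans (s≤s j<Lo) (proj₁ ab)) , proj₂ ab) Ubound))
      main (tri≈ _ refl _) with ul-head (suc k) eq
      ... | rest , p = rest ++ Wl k , cong length (cong (_++ Wl k) p) , ≡→∼ (cong (_++ Wl k) p)
      main (tri> _ _ sLo<j) = go j refl sLo<j
        where
        go : ∀ j₀ → j₀ ≡ j → suc Lo < j₀ → LeftDescent (U ++ Wl k) j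
        go (suc j') refl (s≤s Lo<j') = prefix-descent U (Wl k) j' (suc j')
          (Wdesc k j' (inrun (suc k) j' eq Lo<j' (≤-trans (n≤1+n j') j≤)) (≤-pred j≤))
          (ul-shift (suc k) j' eq Lo<j' j≤)


module RunPermutation (r0 n' : ℕ) (c : ℕ → Bool) (c0 : c 0 ≡ false) where

  open import Data.Nat hiding (_≟_)
  open import Data.Nat.Properties
  open import Data.List using (List; []; _∷_; _++_)
  open import Data.Product using (_×_; _,_; proj₁; proj₂)
  open import Data.Sum using (_⊎_; inj₁; inj₂)
  open import Data.Empty using (⊥-elim)
  open import Relation.Binary.PropositionalEquality hiding ([_]; _≗_)
  open import Relation.Nullary using (yes; no)
  open Counting
  open Model r0 (suc n')
  open Runs c c0

  Cyc : ℕ → ℕ → (ℕ → ℕ) → Set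
  Cyc l k f = f k ≡ l × (∀ y → l ≤ y → y < k → f y ≡ suc y) × (∀ y → y < l → f y ≡ y) × (∀ y → k < y → f y ≡ y)

  qN : List ℕ → ℕ → ℕ
  qN gs = q (evN gs)

  qN-++ : ∀ a b x → qN (a ++ b) x ≡ qN a (qN b x)
  qN-++ a b x = eqq (evN-++ a b) x

  ul-cyc : ∀ k → c k ≡ true → Cyc (lo k) k (qN (ul k))
  ul-cyc zero h = ⊥-elim (not-cut-0 h)
  ul-cyc (suc k') h = caseB (c k') refl
    where
    K : ℕ
    K = suc k'
    f : ℕ → ℕ
    f = qN (ul K)
    feq : ∀ y → f y ≡ qN (ul k') (sw k' y)
    feq y = trans (cong (λ z → qN z y) (ul-true k' h)) (qN-++ (ul k') (K ∷ []) y)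
    caseB : (b : Bool) → c k' ≡ b → Cyc (lo K) K f
    caseB false e = subst (λ l → Cyc l K f) (sym (trans (lo-true k' h) (lo-false k' e)))
      ( trans (feq K) (trans (cong (λ z → qN z (sw k' K)) (ul-false k' e)) (sw-sm k'))
      , (λ y l≤y y<K → trans (feq y) (trans (cong (λ z → qN z (sw k' y)) (ul-false k' e)) (trans (cong (sw k') (≤-antisym (≤-pred y<K) l≤y)) (trans (sw-m k') (cong suc (sym (≤-antisym (≤-pred y<K) l≤y)))))))
      , (λ y y<l → trans (feq y) (trans (cong (λ z → qN z (sw k' y)) (ul-false k' e)) (sw-lt k' y y<l)))
      , (λ y K<y → trans (feq y) (trans (cong (λ z → qN z (sw k' y)) (ul-false k' e)) (sw-gt k' y K<y))) )
    caseB true e with ul-cyc k' e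
    ... | (iK , iM , iL , iH) = subst (λ l → Cyc l K f) (sym (lo-true k' h))
      ( trans (feq K) (trans (cong (qN (ul k')) (sw-sm k')) iK)
      , (λ y l≤y y<K → trans (feq y) (mid y l≤y y<K))
      , (λ y y<l → trans (feq y) (trans (cong (qN (ul k')) (sw-lt k' y (<-≤-trans y<l (lo≤ k')))) (iL y y<l)))
      , (λ y K<y → trans (feq y) (trans (cong (qN (ul k')) (sw-gt k' y K<y)) (iH y (<-trans (n<1+n k') K<y)))) )
      where
      mid : ∀ y → lo k' ≤ y → y < K → qN (ul k') (sw k' y) ≡ suc y
      mid y l≤y (s≤s y≤k') with m≤n⇒m<n∨m≡n y≤k'
      ... | inj₁ y<k' = trans (cong (qN (ul k')) (sw-lt k' y y<k')) (iM y l≤y y<k')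
      ... | inj₂ refl = trans (cong (qN (ul k')) (sw-m y)) (iH (suc y) (n<1+n y))

  module CycFacts {l k : ℕ} {f : ℕ → ℕ} (C : Cyc l k f) where

    cyc-top : f k ≡ l
    cyc-top = proj₁ C

    cyc-fix-above : ∀ y → k < y → f y ≡ y
    cyc-fix-above = proj₂ (proj₂ (proj₂ C))

    cyc-val : ∀ y → y < k → (y < l × f y ≡ y) ⊎ (l ≤ y × f y ≡ suc y)
    cyc-val y y<k with y <? l
    ... | yes y<l = inj₁ (y<l , proj₁ (proj₂ (proj₂ C)) y y<l)
    ... | no y≮l = inj₂ (≮⇒≥ y≮l , proj₁ (proj₂ C) y (≮⇒≥ y≮l) y<k)

    cyc-inflationary : ∀ y → y < k → y ≤ f y
    cyc-inflationary y y<k with cyc-val y y<k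
    ... | inj₁ (_ , p) = ≤-reflexive (sym p)
    ... | inj₂ (_ , p) = subst (y ≤_) (sym p) (n≤1+n y)

    cyc-bounded : ∀ y → y < k → f y ≤ k
    cyc-bounded y y<k with cyc-val y y<k
    ... | inj₁ (_ , p) = subst (_≤ k) (sym p) (<⇒≤ y<k)
    ... | inj₂ (_ , p) = subst (_≤ k) (sym p) y<k

    cyc-mono : ∀ a b → a < b → b < k → f a < f b
    cyc-mono a b a<b b<k with cyc-val a (<-trans a<b b<k) | cyc-val b b<k
    ... | inj₁ (_ , pa) | inj₁ (_ , pb) = subst₂ _<_ (sym pa) (sym pb) a<b
    ... | inj₁ (_ , pa) | inj₂ (_ , pb) = subst₂ _<_ (sym pa) (sym pb) (<-trans a<b (n<1+n b))
    ... | inj₂ (la , pa) | inj₁ (bl , pb) = ⊥-elim (<-irrefl refl (<-≤-trans (<-trans a<b bl) la))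
    ... | inj₂ (_ , pa) | inj₂ (_ , pb) = subst₂ _<_ (sym pa) (sym pb) (s≤s a<b)

  lo-same : ∀ v u → lo v ≤ u → u ≤ v → lo u ≡ lo v
  lo-same zero u l≤u u≤v = cong lo (≤-antisym u≤v z≤n)
  lo-same (suc v) u l≤u u≤v with m≤n⇒m<n∨m≡n u≤v
  ... | inj₂ refl = refl
  ... | inj₁ (s≤s u≤v') with c (suc v) in eq
  ...   | false = ⊥-elim (<-irrefl refl (≤-<-trans l≤u (s≤s u≤v')))
  ...   | true = lo-same v u l≤u u≤v'

  ≤-suc-split : ∀ {k} (P : ℕ → Set) x → x ≤ suc k → (∀ y → y ≤ k → P y) → P (suc k) → P x
  ≤-suc-split P x x≤K f p with m≤n⇒m<n∨m≡n x≤K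
  ... | inj₁ (s≤s x≤k) = f x x≤k
  ... | inj₂ refl = p

  qW : ℕ → ℕ → ℕ
  qW k = qN (Wl k)

  record Jinv (k : ℕ) : Set where
    field
      fixes-above : ∀ x → k < x → qW k x ≡ x
      bounded     : ∀ x → x ≤ k → qW k x ≤ k
      lo-below    : ∀ x → x ≤ k → lo x ≤ qW k x
      cuts-up-to  : ∀ x → x ≤ k → ∀ g → lo x < g → g ≤ qW k x → c g ≡ true
      reverses    : ∀ u v → lo v ≤ u → u < v → v ≤ k → qW k v < qW k u
  open Jinv

  J0 : Jinv 0
  J0 = record
    { fixes-above = λ x _ → refl
    ; bounded     = λ x x≤0 → x≤0
    ; lo-below    = λ x _ → lo≤ x
    ; cuts-up-to  = λ { zero _ g lt g≤ → ⊥-elim (<-irrefl refl (<-≤-trans lt g≤)) ; (suc x) () }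
    ; reverses    = λ u v _ u<v v≤0 → ⊥-elim (<-irrefl refl (<-≤-trans u<v (≤-trans v≤0 z≤n))) }

  -- At a non-cut k + 1, Wl (k+1) = Wl k and k + 1 starts a new run.
  Jstep-noncut : ∀ k → c (suc k) ≡ false → Jinv k → Jinv (suc k)
  Jstep-noncut k e J = record
    { fixes-above = λ x K<x → trans (same x) (fixes-above J x (<-trans (n<1+n k) K<x))
    ; bounded     = λ x x≤K → ≤-suc-split (λ x → qW K x ≤ K) x x≤K
                      (λ x x≤k → ≤-trans (subst (_≤ k) (sym (same x)) (bounded J x x≤k)) (n≤1+n k))
                      (≤-reflexive qK)
    ; lo-below    = λ x x≤K → ≤-suc-split (λ x → lo x ≤ qW K x) x x≤K
                      (λ x x≤k → subst (lo x ≤_) (sym (same x)) (lo-below J x x≤k))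
                      (subst (lo K ≤_) (sym qK) (lo≤ K))
    ; cuts-up-to  = λ x x≤K → ≤-suc-split (λ x → ∀ g → lo x < g → g ≤ qW K x → c g ≡ true) x x≤K
                      (λ x x≤k g lt g≤ → cuts-up-to J x x≤k g lt (subst (g ≤_) (same x) g≤))
                      (λ g lt g≤ → ⊥-elim (<-irrefl refl (<-≤-trans lt (subst (g ≤_) (trans qK (sym (lo-false K e))) g≤))))
    ; reverses    = λ u v l≤u u<v v≤K → ≤-suc-split (λ v → lo v ≤ u → u < v → qW K v < qW K u) v v≤K
                      (λ v v≤k l≤u u<v → subst₂ _<_ (sym (same v)) (sym (same u)) (reverses J u v l≤u u<v v≤k))
                      (λ l≤u u<v → ⊥-elim (<-irrefl refl (<-≤-trans u<v (subst (_≤ u) (lo-false K e) l≤u)))) l≤u u<v }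
    where
    K : ℕ
    K = suc k
    same : ∀ x → qW K x ≡ qW k x
    same x = trans (qN-++ (ul K) (Wl k) x) (cong (λ z → qN z (qW k x)) (ul-false K e))
    qK : qW K K ≡ K
    qK = trans (same K) (fixes-above J K (n<1+n k))

  -- At a cut k + 1, Wl (k+1) = ul (k+1) Wl k where ul (k+1) cycles the run
  -- ending at k + 1 one step up and sends k + 1 to its bottom lo (k + 1).
  Jstep-cut : ∀ k → c (suc k) ≡ true → Jinv k → Jinv (suc k)
  Jstep-cut k e J = record
    { fixes-above = λ x K<x → trans (qeq x) (trans (cong qU (fixes-above J x (<-trans (n<1+n k) K<x))) (cyc-fix-above x K<x))
    ; bounded     = λ x x≤K → ≤-suc-split (λ x → qW K x ≤ K) x x≤K
                      (λ x x≤k → subst (_≤ K) (sym (qeq x)) (cyc-bounded (qW k x) (s≤s (bounded J x x≤k))))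
                      (subst (_≤ K) (sym qK) (lo≤ K))
    ; lo-below    = λ x x≤K → ≤-suc-split (λ x → lo x ≤ qW K x) x x≤K
                      (λ x x≤k → ≤-trans (lo-below J x x≤k) (subst (qW k x ≤_) (sym (qeq x)) (cyc-inflationary (qW k x) (s≤s (bounded J x x≤k)))))
                      (≤-reflexive (sym qK))
    ; cuts-up-to  = λ x x≤K → ≤-suc-split (λ x → ∀ g → lo x < g → g ≤ qW K x → c g ≡ true) x x≤K
                      (λ x x≤k g lt g≤ → cuts-below x x≤k g lt (subst (g ≤_) (qeq x) g≤))
                      (λ g lt g≤ → ⊥-elim (<-irrefl refl (<-≤-trans lt (subst (g ≤_) qK g≤))))
    ; reverses    = λ u v l≤u u<v v≤K → ≤-suc-split (λ v → lo v ≤ u → u < v → qW K v < qW K u) v v≤K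
                      (λ v v≤k l≤u u<v → subst₂ _<_ (sym (qeq v)) (sym (qeq u))
                         (cyc-mono (qW k v) (qW k u) (reverses J u v l≤u u<v v≤k) (s≤s (bounded J u (≤-trans (<⇒≤ u<v) v≤k)))))
                      (λ l≤u u<v → subst (_< qW K u) (sym qK) (top-above u l≤u u<v)) l≤u u<v }
    where
    K : ℕ
    K = suc k
    qU : ℕ → ℕ
    qU = qN (ul K)
    Lo : ℕ
    Lo = lo K
    open CycFacts (ul-cyc K e)
    qeq : ∀ x → qW K x ≡ qU (qW k x)
    qeq x = qN-++ (ul K) (Wl k) x
    qK : qW K K ≡ Lo
    qK = trans (qeq K) (trans (cong qU (fixes-above J K (n<1+n k))) cyc-top)
    cuts-below : ∀ x → x ≤ k → ∀ g → lo x < g → g ≤ qU (qW k x) → c g ≡ true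
    cuts-below x x≤k g lt g≤ with cyc-val (qW k x) (s≤s (bounded J x x≤k))
    ... | inj₁ (_ , p) = cuts-up-to J x x≤k g lt (subst (g ≤_) p g≤)
    ... | inj₂ (l≤y , p) with m≤n⇒m<n∨m≡n (subst (g ≤_) p g≤)
    ...   | inj₁ (s≤s g≤y) = cuts-up-to J x x≤k g lt g≤y
    ...   | inj₂ refl = inrun K (suc (qW k x)) e (s≤s l≤y) (s≤s (bounded J x x≤k))
    top-above : ∀ u → Lo ≤ u → u < K → Lo < qW K u
    top-above u l≤u (s≤s u≤k) with cyc-val (qW k u) (s≤s (bounded J u u≤k))
    ... | inj₁ (y<l , _) = ⊥-elim (<-irrefl refl (<-≤-trans y<l
            (subst (_≤ qW k u) (lo-same K u l≤u (≤-trans u≤k (n≤1+n k))) (lo-below J u u≤k))))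
    ... | inj₂ (l≤y , p) = subst (Lo <_) (sym (trans (qeq u) p)) (s≤s l≤y)

  Jall : ∀ k → Jinv k
  Jall zero = J0
  Jall (suc k) with c (suc k) in e
  ... | false = Jstep-noncut k e (Jall k)
  ... | true  = Jstep-cut k e (Jall k)


-- The rows a < m with nb a, in increasing order: the indices of the factors
-- t_{a+1} of the test element.
module Rows (nb : ℕ → Bool) where

  open import Data.Nat using (zero; suc; _<_)
  open import Data.Nat.Properties using (<-trans; n<1+n)
  open import Data.List using (List; []; _∷_; _++_)
  open import Data.List.Relation.Unary.All using (All; []; _∷_)
  import Data.List.Relation.Unary.All as All
  import Data.List.Relation.Unary.All.Properties as AllP

  rowsB : Bool → ℕ → List ℕ
  rowsB true m = m ∷ []
  rowsB false m = []

  rowsUp : ℕ → List ℕ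
  rowsUp zero = []
  rowsUp (suc m) = rowsUp m ++ rowsB (nb m) m

  rows-bound : ∀ m → All (_< m) (rowsUp m)
  rows-bound zero = []
  rows-bound (suc m) = AllP.++⁺ (All.map (λ h → <-trans h (n<1+n m)) (rows-bound m)) (last (nb m))
    where
    last : ∀ b → All (_< suc m) (rowsB b m)
    last true = n<1+n m ∷ []
    last false = []


module TestWord (r n' : ℕ) (c : ℕ → Bool) (c0 : c 0 ≡ false) (nb : ℕ → Bool) where

  open import Data.Nat using (_≤_)
  open import Data.Nat.Properties using (≤-pred)
  open import Data.List using (List; _++_; map)
  open import Data.List.Relation.Unary.All using (All)
  import Data.List.Relation.Unary.All as All
  open import Defs
  open G r (suc n')
  open Runs c c0
  open Rows nb
  open PiWords r n'

  ts : List ℕ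
  ts = rowsUp (suc n')

  ts-bound : All (_≤ n') ts
  ts-bound = All.map ≤-pred (rows-bound (suc n'))

  xs : List PiElt
  xs = map tE' ts ++ map sE' (Wl n')


-- The lower bound Θ(test word) ≥ its length, split into inversions (coming
-- from the run word) and colours (coming from the t's).
module CountingBounds (r0 n' : ℕ) (c : ℕ → Bool) (c0 : c 0 ≡ false) (blk : ℕ → ℕ) (V : ℕ → Bool) (nb : ℕ → Bool) where

  open import Data.Nat hiding (_≟_)
  open import Data.Nat.Properties
  open import Data.Nat.DivMod
  open import Data.Bool using () renaming (_≟_ to _≟B_)
  open import Data.List using (List; []; _∷_; _++_; length; concatMap)
  open import Data.List.Properties using (length-++; ++-assoc; ++-identityʳ)
  open import Data.List.Relation.Unary.All using (All; []; _∷_)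
  open import Data.Product using (_×_; _,_; proj₁; proj₂)
  open import Data.Sum using (inj₁; inj₂)
  open import Data.Empty using (⊥-elim)
  open import Relation.Nullary using (Dec; yes; no)
  open import Relation.Nullary.Decidable using (_×-dec_)
  open import Relation.Binary.PropositionalEquality hiding ([_]; _≗_)
  open Counting
  open Model r0 (suc n')
  open Statistic r0 (suc n') blk V
  open Runs c c0
  open RunPermutation r0 n' c c0
  open Rows nb

  n : ℕ
  n = suc n'

  interval : ∀ m a b → b ≤ m → Σ< m (λ u → ⟦ (a ≤? u) ×-dec (u <? b) ⟧) ≡ b ∸ a
  interval zero a zero z≤n = sym (0∸n≡0 a)
  interval (suc m) a b b≤ with m≤n⇒m<n∨m≡n b≤
  ... | inj₁ (s≤s b≤m) = trans (cong₂ _+_ (interval m a b b≤m) (⟦⟧-no ((a ≤? m) ×-dec (m <? b)) (λ p → <-irrefl refl (<-≤-trans (proj₂ p) b≤m))))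
                                (+-identityʳ _)
  ... | inj₂ refl = begin
      Σ< m (λ u → ⟦ (a ≤? u) ×-dec (u <? suc m) ⟧) + ⟦ (a ≤? m) ×-dec (m <? suc m) ⟧
        ≡⟨ cong₂ _+_ (trans (Σ-ext m (λ u u<m → ⟦⟧-cong ((a ≤? u) ×-dec (u <? suc m)) ((a ≤? u) ×-dec (u <? m))
                                    (λ p → proj₁ p , u<m) (λ p → proj₁ p , <-trans (proj₂ p) (n<1+n m))))
                          (interval m a m ≤-refl))
                     (⟦⟧-cong ((a ≤? m) ×-dec (m <? suc m)) (a ≤? m) proj₁ (λ p → p , n<1+n m)) ⟩
      m ∸ a + ⟦ a ≤? m ⟧
        ≡⟨ lem (a ≤? m) ⟩
      suc m ∸ a ∎
    where
    open ≡-Reasoning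
    lem : (d : Dec (a ≤ m)) → m ∸ a + ⟦ d ⟧ ≡ suc m ∸ a
    lem (yes a≤m) = trans (+-comm (m ∸ a) 1) (sym (+-∸-assoc 1 a≤m))
    lem (no a≰m) = trans (+-identityʳ _) (trans (m≤n⇒m∸n≡0 (≤-trans (n≤1+n m) (≰⇒> a≰m))) (sym (m≤n⇒m∸n≡0 (≰⇒> a≰m))))

  len-Wl : ∀ k → length (Wl k) ≡ Σ< (suc k) dn
  len-Wl zero = refl
  len-Wl (suc k) = trans (length-++ (ul (suc k))) (trans (cong₂ _+_ (len-ul (suc k)) (len-Wl k)) (+-comm (dn (suc k)) _))

  -- If the blocks are monotone in the position and every cut raises the block,
  -- then every pair u < v of one run is a block-crossing inversion of qW n', and
  -- these pairs (dn v of them for each v) show length (Wl n') ≤ Φ.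
  module InversionBound (blkmono : ∀ a b → a ≤ b → blk a ≤ blk b)
            (blkcut : ∀ g → c g ≡ true → blk (pred g) < blk g) where

    JJ : Jinv n'
    JJ = Jall n'

    inv-pair : ∀ u v → lo v ≤ u → u < v → v ≤ n' → Inv (qW n') u v
    inv-pair u v l≤u u<v v≤ = u<v , b<a , ne
      where
      a : ℕ
      a = qW n' u
      b : ℕ
      b = qW n' v
      b<a : b < a
      b<a = Jinv.reverses JJ u v l≤u u<v v≤
      u≤ : u ≤ n'
      u≤ = ≤-trans (<⇒≤ u<v) v≤
      lou : lo u ≡ lo v
      lou = lo-same v u l≤u (<⇒≤ u<v)
      lo<a : lo u < a
      lo<a = ≤-<-trans (subst (_≤ b) (sym lou) (Jinv.lo-below JJ v v≤)) b<a
      ca : c a ≡ true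
      ca = Jinv.cuts-up-to JJ u u≤ a lo<a ≤-refl
      ne : blk a ≢ blk b
      ne e = <-irrefl (sym e) (≤-<-trans (blkmono b (pred a) (pred-mono-≤ b<a)) (blkcut a ca))

    Φ-lower : ∀ x → (∀ u → q x u ≡ qW n' u) → length (Wl n') ≤ Φ x
    Φ-lower x hq = begin
      length (Wl n')
        ≡⟨ len-Wl n' ⟩
      Σ< n dn
        ≡⟨ Σ-ext n (λ v v<n → sym (trans (interval n (lo v) v (<⇒≤ v<n)) (m∸[m∸n]≡n (dn≤ v)))) ⟩
      Σ< n (λ v → Σ< n (λ u → ⟦ (lo v ≤? u) ×-dec (u <? v) ⟧))
        ≡⟨ sym (Σ-comm n n (λ u v → ⟦ (lo v ≤? u) ×-dec (u <? v) ⟧)) ⟩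
      ΣΣ n (λ u v → ⟦ (lo v ≤? u) ×-dec (u <? v) ⟧)
        ≤⟨ Σ-mono n (λ u _ → Σ-mono n (λ v v<n → ⟦⟧-mono ((lo v ≤? u) ×-dec (u <? v)) (Inv? (q x) u v)
              (λ p → conv u v (inv-pair u v (proj₁ p) (proj₂ p) (≤-pred v<n))))) ⟩
      Φ x ∎
      where
      open ≤-Reasoning
      conv : ∀ u v → Inv (qW n') u v → Inv (q x) u v
      conv u v (a , b , e) = a , subst₂ _<_ (sym (hq v)) (sym (hq u)) b , subst₂ (λ s t → blk s ≢ blk t) (sym (hq u)) (sym (hq v)) e

  concatMap-++ : ∀ {A B : Set} (f : A → List B) xs ys → concatMap f (xs ++ ys) ≡ concatMap f xs ++ concatMap f ys
  concatMap-++ f [] ys = refl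
  concatMap-++ f (x ∷ xs) ys = trans (cong (f x ++_) (concatMap-++ f xs ys)) (sym (++-assoc (f x) _ _))

  Dfun : ℕ → ℕ → ℕ
  Dfun m u = ⟦ (u <? m) ×-dec (nb u ≟B true) ⟧

  Dm : ℕ → M
  Dm m = mk (λ u → u) (Dfun m)

  evDT : ∀ m → evN (concatMap tN (rowsUp m)) ≗ Dm m
  evDT zero = (λ u → refl) , (λ u → cong (_% r) (sym (⟦⟧-no ((u <? 0) ×-dec (nb u ≟B true)) (λ p → <-irrefl refl (<-≤-trans (proj₁ p) z≤n)))))
  evDT (suc m) = ≗-trans (subst (λ z → evN z ≗ evN (concatMap tN (rowsUp m)) · evN (concatMap tN (rowsB (nb m) m)))
                          (sym (concatMap-++ tN (rowsUp m) (rowsB (nb m) m))) (evN-++ (concatMap tN (rowsUp m)) (concatMap tN (rowsB (nb m) m))))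
                        (caseB (nb m) refl)
    where
    caseB : (b : Bool) → nb m ≡ b → evN (concatMap tN (rowsUp m)) · evN (concatMap tN (rowsB (nb m) m)) ≗ Dm (suc m)
    caseB true e rewrite e = ≗-trans (·-cong (evDT m) (subst (λ z → evN z ≗ tM m) (sym (++-identityʳ (tN m))) (evN-tN m)))
                                     ((λ u → refl) , (λ u → cong (_% r) (lem u)))
      where
      lem : ∀ u → Dfun m u + ⟦ u ≟ m ⟧ ≡ Dfun (suc m) u
      lem u with u ≟ m
      ... | yes refl = trans (cong (_+ 1) (⟦⟧-no ((u <? u) ×-dec (nb u ≟B true)) (λ p → <-irrefl refl (proj₁ p))))
                             (sym (⟦⟧-yes ((u <? suc u) ×-dec (nb u ≟B true)) (n<1+n u , e)))
      ... | no u≢m = trans (+-identityʳ _) (⟦⟧-cong ((u <? m) ×-dec (nb u ≟B true)) ((u <? suc m) ×-dec (nb u ≟B true))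
                        (λ p → <-trans (proj₁ p) (n<1+n m) , proj₂ p)
                        (λ p → ≤∧≢⇒< (≤-pred (proj₁ p)) u≢m , proj₂ p))
    caseB false e rewrite e = ≗-trans (·-e _) (≗-trans (evDT m) ((λ u → refl) , (λ u → cong (_% r) (lem u))))
      where
      lem : ∀ u → Dfun m u ≡ Dfun (suc m) u
      lem u = ⟦⟧-cong ((u <? m) ×-dec (nb u ≟B true)) ((u <? suc m) ×-dec (nb u ≟B true))
                (λ p → <-trans (proj₁ p) (n<1+n m) , proj₂ p)
                (λ p → ≤∧≢⇒< (≤-pred (proj₁ p)) (λ { refl → true≢false (trans (sym (proj₂ p)) e) }) , proj₂ p)

  len-rowsUp : ∀ m → Σ< m (λ u → ⟦ nb u ≟B true ⟧) ≡ length (rowsUp m)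
  len-rowsUp zero = refl
  len-rowsUp (suc m) = trans (cong₂ _+_ (len-rowsUp m) (lem (nb m))) (sym (length-++ (rowsUp m)))
    where
    lem : ∀ b → ⟦ b ≟B true ⟧ ≡ length (rowsB b m)
    lem true = refl
    lem false = refl

  reindexN : ∀ gs → All (λ g → 1 ≤ g × g ≤ n') gs → ∀ (h : ℕ → ℕ) → Σ< n (λ u → h (qN gs u)) ≡ Σ< n h
  reindexN [] [] h = refl
  reindexN (suc m ∷ gs) ((_ , g≤) ∷ hs) h = trans (reindexN gs hs (λ u → h (sw m u))) (Σ-sw n m h (s≤s g≤))

  d-zeroN : ∀ gs → All (λ g → 1 ≤ g × g ≤ n') gs → ∀ u → d (evN gs) u ≡ 0
  d-zeroN [] [] u = refl
  d-zeroN (suc m ∷ gs) (_ ∷ hs) u = d-zeroN gs hs u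

  -- If every coloured row is in V, then each row contributes a coloured
  -- V-value, so length (rowsUp n) ≤ Ψ.
  module ColourBound (cb : ∀ g → c g ≡ true → g ≤ n') (HV : ∀ u → u < n → nb u ≡ true → V u ≡ true) where

    Wbound : All (λ g → 1 ≤ g × g ≤ n') (Wl n')
    Wbound = Data.List.Relation.Unary.All.map (λ {g} cg → pos g cg , cb g cg) (Wl-letters n')
      where
      pos : ∀ g → c g ≡ true → 1 ≤ g
      pos zero cg = ⊥-elim (not-cut-0 cg)
      pos (suc g) _ = s≤s z≤n

    QW : M
    QW = evN (Wl n')

    Ψ-lower : length (rowsUp n) ≤ Ψ (Dm n · QW)
    Ψ-lower = begin
      length (rowsUp n)
        ≡⟨ sym (len-rowsUp n) ⟩
      Σ< n (λ u → ⟦ nb u ≟B true ⟧)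
        ≤⟨ Σ-mono n (λ u u<n → ⟦⟧-mono (nb u ≟B true) (H? u) (λ e → e , u<n)) ⟩
      Σ< n (λ u → ⟦ H? u ⟧)
        ≡⟨ sym (reindexN (Wl n') Wbound (λ u → ⟦ H? u ⟧)) ⟩
      Σ< n (λ u → ⟦ H? (qN (Wl n') u) ⟧)
        ≤⟨ Σ-mono n (λ u _ → ⟦⟧-mono (H? (qN (Wl n') u)) (Col? (Dm n · QW) u) (col u)) ⟩
      Ψ (Dm n · QW) ∎
      where
      open ≤-Reasoning
      H? : ∀ a → Dec (nb a ≡ true × a < n)
      H? a = (nb a ≟B true) ×-dec (a <? n)
      col : ∀ u → nb (qN (Wl n') u) ≡ true × qN (Wl n') u < n → Col (Dm n · QW) u
      col u (e , lt) = HV _ lt e , λ z → 1≢0 (trans (sym (cong (_% r) eq1)) z)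
        where
        eq1 : Dfun n (qN (Wl n') u) + d QW u ≡ 1
        eq1 = trans (cong₂ _+_ (⟦⟧-yes ((qN (Wl n') u <? n) ×-dec (nb (qN (Wl n') u) ≟B true)) (lt , e)) (d-zeroN (Wl n') Wbound u)) refl
        1≢0 : 1 % r ≢ 0
        1≢0 ()


module TestLength (r0 n' : ℕ) (c : ℕ → Bool) (c0 : c 0 ≡ false) (blk : ℕ → ℕ) (V : ℕ → Bool) (nb : ℕ → Bool) where

  open import Data.Nat hiding (_≟_)
  open import Data.Nat.Properties
  open import Data.List using ([]; _∷_; _++_; length; concatMap; map)
  open import Data.List.Relation.Unary.All using (All; []; _∷_)
  import Data.List.Relation.Unary.All as All
  import Data.List.Relation.Unary.All.Properties as AllP
  open import Relation.Binary.PropositionalEquality hiding ([_]; _≗_)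
  open Counting
  open Model r0 (suc n')
  open Statistic r0 (suc n') blk V
  open Runs c c0
  open CountingBounds r0 n' c c0 blk V nb
  open Letters (suc (suc r0)) n'
  open SwapST (suc (suc r0)) n' using (tN-bound)
  open PiWords (suc (suc r0)) n'
  open TestWord (suc (suc r0)) n' c c0 nb

  ev-Lw : ∀ ys → All (_≤ n') ys → ev (Lw ys) ≗ evN ys
  ev-Lw [] [] = ≗-refl
  ev-Lw (y ∷ ys) (h ∷ hs) = ·-cong (subst (λ z → genM z true ≗ genM y true) (sym (toℕ-toF y h)) ≗-refl) (ev-Lw ys hs)

  module Bound (cb : ∀ g → c g ≡ true → g ≤ n') (HV : ∀ u → u < n → nb u ≡ true → V u ≡ true)
               (blkmono : ∀ a b → a ≤ b → blk a ≤ blk b)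
               (blkcut : ∀ g → c g ≡ true → blk (pred g) < blk g) where

    open InversionBound blkmono blkcut
    open ColourBound cb HV

    letters-bound : All (_≤ n') (concatMap tN ts ++ Wl n')
    letters-bound = AllP.++⁺ (AllP.concat⁺ (AllP.map⁺ (All.map (λ {a} a≤ → All.map (λ h → ≤-trans h a≤) (tN-bound a)) ts-bound)))
                             (All.map (λ {g} cg → cb g cg) (Wl-letters n'))

    -- The test word evaluates to (row colours) · (run permutation), whose
    -- inversions and colours are counted by CountingBounds.
    lower : length xs ≤ Θ (ev (wordP xs))
    lower = begin
      length xs
        ≡⟨ trans (len-TS ts (Wl n')) (+-comm (length ts) _) ⟩
      length (Wl n') + length ts
        ≤⟨ +-mono-≤ (Φ-lower (Dm n · QW) (λ u → refl)) Ψ-lower ⟩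
      Θ (Dm n · QW)
        ≡⟨ sym (Θ-cong eqv) ⟩
      Θ (ev (wordP xs)) ∎
      where
      open ≤-Reasoning
      eqv : ev (wordP xs) ≗ Dm n · QW
      eqv = subst (λ z → ev z ≗ Dm n · QW) (sym (word-TS ts (Wl n') ts-bound))
              (≗-trans (ev-Lw _ letters-bound) (≗-trans (evN-++ (concatMap tN ts) (Wl n')) (·-cong (evDT n) ≗-refl)))


module TestDescents (r n' : ℕ) (c : ℕ → Bool) (c0 : c 0 ≡ false) (cb : ∀ g → c g ≡ true → g ≤ n') (nb : ℕ → Bool) where

  open import Data.Nat hiding (_≟_)
  open import Data.Nat.Properties
  open import Data.List using (List; []; _∷_; _++_; length; concatMap; map)
  open import Data.List.Properties using (++-assoc; map-++; length-map)
  open import Data.List.Relation.Unary.All using (All; []; _∷_)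
  open import Data.List.Relation.Unary.Any using (Any)
  import Data.List.Relation.Unary.All as All
  open import Data.Product using (_,_)
  open import Data.Empty using (⊥-elim)
  open import Relation.Binary.PropositionalEquality hiding ([_])
  open Counting using (tN; sw)
  open import Defs
  open G r (suc n')
  open Runs c c0
  open Letters r n'
  open MoveT r n'
  open RunDescents r n' c c0 cb
  open PiWords r n'
  open TestWord r n' c c0 nb

  n : ℕ
  n = suc n'

  -- Every row a gives the left descent t_{a+1} (the t's commute).
  t-desc : ∀ a → Any (a ≡_) ts → PiDescent xs (tE' a)
  t-desc a m with t-to-front ts a ts-bound m
  ... | ts' , len , hs' , eq = map tE' ts' ++ map sE' (Wl n') ,
    trans (len-TS ts (Wl n')) (trans (cong (_+ length (Wl n')) len) (cong suc (sym (len-TS ts' (Wl n'))))) ,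
    subst₂ _≈G_ (sym (word-TS ts (Wl n') ts-bound)) as-Π-word (∼congʳ (Wl n') eq)
    where
    a≤ : a ≤ n'
    a≤ = All.lookup ts-bound m
    as-Π-word : Lw ((tN a ++ concatMap tN ts') ++ Wl n') ≡ wordP (tE' a ∷ map tE' ts' ++ map sE' (Wl n'))
    as-Π-word = begin
      Lw ((tN a ++ concatMap tN ts') ++ Wl n')
        ≡⟨ cong Lw (++-assoc (tN a) _ _) ⟩
      Lw (tN a ++ concatMap tN ts' ++ Wl n')
        ≡⟨ map-++ Lt (tN a) _ ⟩
      Lw (tN a) ++ Lw (concatMap tN ts' ++ Wl n')
        ≡⟨ cong₂ _++_ (sym (pw-tE' a a≤)) (sym (word-TS ts' (Wl n') hs')) ⟩
      piWord (tE' a) ++ wordP (map tE' ts' ++ map sE' (Wl n')) ∎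
      where open ≡-Reasoning

  -- Every cut j gives the left descent s_j: it is a descent of the run word,
  -- and moves to the front across the t's by conjugating their indices.
  s-desc : ∀ j → c j ≡ true → PiDescent xs (sE' j)
  s-desc zero cj = ⊥-elim (not-cut-0 cj)
  s-desc (suc j') cj with Wdesc n' (suc j') cj (cb (suc j') cj)
  ... | W' , lenW , eqW = map tE' ts'' ++ map sE' W' ,
    trans (len-TS ts (Wl n')) (trans (cong (length ts +_) lenW) (trans (+-suc (length ts) (length W')) (cong suc (trans (cong (_+ length W') (sym (length-map (sw j') ts))) (sym (len-TS ts'' W')))))) ,
    subst₂ _≈G_ (sym (word-TS ts (Wl n') ts-bound)) as-Π-word
      ((concatMap tN ts ++ Wl n')
         ∼⟨ ∼congˡ (concatMap tN ts) eqW ⟩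
       (concatMap tN ts ++ suc j' ∷ W')
         ≡∼⟨ sym (++-assoc (concatMap tN ts) (suc j' ∷ []) W') ⟩
       ((concatMap tN ts ++ suc j' ∷ []) ++ W')
         ∼⟨ ∼congʳ W' (ts-s-swap j' ts (cb (suc j') cj) ts-bound) ⟩
       (suc j' ∷ concatMap tN ts'' ++ W') ∎∼)
    where
    ts'' : List ℕ
    ts'' = map (sw j') ts
    hs'' : All (_≤ n') ts''
    hs'' = Data.List.Relation.Unary.All.Properties.map⁺ (All.map (λ {x} h → sw-bound j' x (cb (suc j') cj) h) ts-bound)
      where import Data.List.Relation.Unary.All.Properties
    as-Π-word : Lw (suc j' ∷ concatMap tN ts'' ++ W') ≡ wordP (sE' (suc j') ∷ map tE' ts'' ++ map sE' W')
    as-Π-word = cong₂ _++_ (sym (pw-sE' (suc j'))) (sym (word-TS ts'' W' hs''))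


module Profiles where

  open import Data.Nat hiding (_≟_)
  open import Data.Nat.Properties
  open import Data.Nat.ListAction using (sum)
  open import Data.Integer as ℤ using (ℤ; ∣_∣; 0ℤ; +_; -[1+_])
  open import Data.Bool using (Bool)
  open import Data.List using (List; []; _∷_; map)
  open import Data.List.Relation.Unary.All using (All; []; _∷_)
  open import Data.List.Relation.Unary.Any using (Any; here; there; any?)
  open import Data.Product using (_×_; _,_; proj₁; proj₂; Σ)
  open import Data.Empty using (⊥; ⊥-elim)
  open import Relation.Nullary using (Dec; yes; no; ¬_; does)
  open import Relation.Nullary.Decidable using (_×-dec_)
  open import Relation.Binary.PropositionalEquality
  open import Relation.Binary.Definitions using (tri<; tri≈; tri>)
  open import Defs using (blocks)

  -- The profile of a signed composition ν: the blocks (start, end, sign) as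
  -- produced by 'blocks', and for each position k whether s_k ∈ Π_ν (SIn: k is
  -- interior to a block) and whether t_k ∈ Π_ν (TIn: k lies in a positive
  -- block).
  Blk : Set
  Blk = ℕ × ℕ × ℤ

  SP : ℕ → Blk → Set
  SP k blk = Σ ℕ λ a → Σ ℕ λ b → Σ ℤ λ z → blk ≡ (a , b , z) × (a < k × k < b)

  TP : ℕ → Blk → Set
  TP k blk = Σ ℕ λ a → Σ ℕ λ b → Σ ℤ λ z → blk ≡ (a , b , z) × (a < k × k ≤ b × 0ℤ ℤ.< z)

  SP? : ∀ k blk → Dec (SP k blk)
  SP? k (a , b , z) with (a <? k) ×-dec (k <? b)
  ... | yes p = yes (a , b , z , refl , p)
  ... | no ¬p = no λ { (a' , b' , z' , refl , p) → ¬p p }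

  TP? : ∀ k blk → Dec (TP k blk)
  TP? k (a , b , z) with (a <? k) ×-dec ((k ≤? b) ×-dec (0ℤ ℤ.<? z))
  ... | yes p = yes (a , b , z , refl , p)
  ... | no ¬p = no λ { (a' , b' , z' , refl , p) → ¬p p }

  SIn : ℕ → List ℤ → ℕ → Set
  SIn a0 ν k = Any (SP k) (blocks a0 ν)

  TIn : ℕ → List ℤ → ℕ → Set
  TIn a0 ν k = Any (TP k) (blocks a0 ν)

  SIn? : ∀ a0 ν k → Dec (SIn a0 ν k)
  SIn? a0 ν k = any? (SP? k) (blocks a0 ν)

  TIn? : ∀ a0 ν k → Dec (TIn a0 ν k)
  TIn? a0 ν k = any? (TP? k) (blocks a0 ν)

  sB : List ℤ → ℕ → Bool
  sB ν k = does (SIn? 0 ν k)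

  tB : List ℤ → ℕ → Bool
  tB ν k = does (TIn? 0 ν k)

  blocks-ge : ∀ a0 ν → All (λ blk → a0 ≤ proj₁ blk) (blocks a0 ν)
  blocks-ge a0 [] = []
  blocks-ge a0 (z ∷ zs) = ≤-refl ∷ Data.List.Relation.Unary.All.map (λ h → ≤-trans (m≤m+n a0 ∣ z ∣) h) (blocks-ge (a0 + ∣ z ∣) zs)

  none-before : ∀ (P : Blk → Set) a0 ν k → k ≤ a0 → (∀ {blk} → P blk → proj₁ blk < k) → ¬ Any P (blocks a0 ν)
  none-before P a0 ν k k≤ start m = go (blocks a0 ν) (blocks-ge a0 ν) m
    where
    go : ∀ bs → All (λ blk → a0 ≤ proj₁ blk) bs → Any P bs → ⊥
    go (_ ∷ bs) (h ∷ _) (here p) = <-irrefl refl (<-≤-trans (start p) (≤-trans k≤ h))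
    go (_ ∷ bs) (_ ∷ hs) (there m') = go bs hs m'

  noS-after : ∀ a0 ν k → k ≤ a0 → ¬ SIn a0 ν k
  noS-after a0 ν k k≤ = none-before (SP k) a0 ν k k≤ λ { (_ , _ , _ , refl , (a<k , _)) → a<k }

  noT-after : ∀ a0 ν k → k ≤ a0 → ¬ TIn a0 ν k
  noT-after a0 ν k k≤ = none-before (TP k) a0 ν k k≤ λ { (_ , _ , _ , refl , (a<k , _)) → a<k }

  S-after-offset : ∀ a0 ν k → SIn a0 ν k → a0 < k
  S-after-offset a0 ν k m with a0 <? k
  ... | yes p = p
  ... | no ¬p = ⊥-elim (noS-after a0 ν k (≮⇒≥ ¬p) m)

  interior-gap-T : ∀ a0 ν m → SIn a0 ν (suc m) → (TIn a0 ν (suc m) → TIn a0 ν (suc (suc m))) × (TIn a0 ν (suc (suc m)) → TIn a0 ν (suc m))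
  interior-gap-T a0 (z ∷ zs) m (here (a , b , z' , refl , (a<j , j<b))) =
    (λ { (here (_ , _ , _ , refl , (_ , _ , pz))) → here (a0 , _ , z , refl , (<-trans a<j (n<1+n _) , j<b , pz))
       ; (there t) → ⊥-elim (noT-after (a0 + ∣ z ∣) zs (suc m) (<⇒≤ j<b) t) }) ,
    (λ { (here (_ , _ , _ , refl , (_ , _ , pz))) → here (a0 , _ , z , refl , (a<j , <⇒≤ j<b , pz))
       ; (there t) → ⊥-elim (noT-after (a0 + ∣ z ∣) zs (suc (suc m)) j<b t) })
  interior-gap-T a0 (z ∷ zs) m (there s) with S-after-offset (a0 + ∣ z ∣) zs (suc m) s | interior-gap-T (a0 + ∣ z ∣) zs m s
  ... | bnd | (f , g) =
    (λ { (here (_ , _ , _ , refl , (_ , j≤ , _))) → ⊥-elim (<-irrefl refl (<-≤-trans bnd j≤))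
       ; (there t) → there (f t) }) ,
    (λ { (here (_ , _ , _ , refl , (_ , j≤ , _))) → ⊥-elim (<-irrefl refl (<-≤-trans (<-trans bnd (n<1+n _)) j≤))
       ; (there t) → there (g t) })

  S-cons : ∀ a0 z zs k → a0 + ∣ z ∣ ≤ k → SIn a0 (z ∷ zs) k → SIn (a0 + ∣ z ∣) zs k
  S-cons a0 z zs k le (here (_ , _ , _ , refl , (_ , k<b))) = ⊥-elim (<-irrefl refl (<-≤-trans k<b le))
  S-cons a0 z zs k le (there s) = s

  T-cons : ∀ a0 z zs k → a0 + ∣ z ∣ < k → TIn a0 (z ∷ zs) k → TIn (a0 + ∣ z ∣) zs k
  T-cons a0 z zs k le (here (_ , _ , _ , refl , (_ , k≤b , _))) = ⊥-elim (<-irrefl refl (<-≤-trans le k≤b))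
  T-cons a0 z zs k le (there s) = s

  abs-pos : ∀ z → z ≢ 0ℤ → 1 ≤ ∣ z ∣
  abs-pos (+_ zero) h = ⊥-elim (h refl)
  abs-pos (+_ (suc n)) h = s≤s z≤n
  abs-pos -[1+ n ] h = s≤s z≤n

  ℤ-by-abs-sign : ∀ z w → z ≢ 0ℤ → ∣ z ∣ ≡ ∣ w ∣ → (0ℤ ℤ.< z → 0ℤ ℤ.< w) → (0ℤ ℤ.< w → 0ℤ ℤ.< z) → z ≡ w
  ℤ-by-abs-sign (+_ zero) w hz _ _ _ = ⊥-elim (hz refl)
  ℤ-by-abs-sign (+_ (suc a)) (+_ b) hz e f g = cong +_ e
  ℤ-by-abs-sign (+_ (suc a)) -[1+ b ] hz e f g with f (ℤ.+<+ (s≤s z≤n))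
  ... | ()
  ℤ-by-abs-sign -[1+ a ] (+_ zero) hz () f g
  ℤ-by-abs-sign -[1+ a ] (+_ (suc b)) hz e f g with g (ℤ.+<+ (s≤s z≤n))
  ... | ()
  ℤ-by-abs-sign -[1+ a ] -[1+ b ] hz e f g = cong -[1+_] (suc-injective e)

  nonempty-sum : ∀ w ws m → w ≢ 0ℤ → sum (map ∣_∣ (w ∷ ws)) ≡ m → m ≡ 0 → ⊥
  nonempty-sum w ws m hw s m0 = <-irrefl refl (<-≤-trans (abs-pos w hw) (≤-reflexive (m+n≡0⇒m≡0 ∣ w ∣ (trans s m0))))

  head-T : ∀ a0 z zs → z ≢ 0ℤ → (TIn a0 (z ∷ zs) (suc a0) → 0ℤ ℤ.< z) × (0ℤ ℤ.< z → TIn a0 (z ∷ zs) (suc a0))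
  head-T a0 z zs hz =
    (λ { (here (_ , _ , _ , refl , (_ , _ , p))) → p
       ; (there t) → ⊥-elim (noT-after (a0 + ∣ z ∣) zs (suc a0) (subst (_≤ a0 + ∣ z ∣) (+-comm a0 1) (+-monoʳ-≤ a0 (abs-pos z hz))) t) }) ,
    (λ p → here (a0 , a0 + ∣ z ∣ , z , refl , (n<1+n a0 , subst (_≤ a0 + ∣ z ∣) (+-comm a0 1) (+-monoʳ-≤ a0 (abs-pos z hz)) , p)))

  short-block : ∀ a0 z zs w ws → z ≢ 0ℤ → ∣ z ∣ < ∣ w ∣ → SIn a0 (w ∷ ws) (a0 + ∣ z ∣) × ¬ SIn a0 (z ∷ zs) (a0 + ∣ z ∣)
  short-block a0 z zs w ws hz lt =
    here (a0 , a0 + ∣ w ∣ , w , refl , (subst (_≤ a0 + ∣ z ∣) (+-comm a0 1) (+-monoʳ-≤ a0 (abs-pos z hz)) , +-monoʳ-< a0 lt)) ,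
    λ { (here (_ , _ , _ , refl , (_ , k<b))) → <-irrefl refl k<b
      ; (there s) → noS-after (a0 + ∣ z ∣) zs (a0 + ∣ z ∣) ≤-refl s }

  -- A signed composition is determined by its profile: compare the first blocks
  -- (lengths by short-block, signs by head-T), then recurse on the tails.
  profile-injective : ∀ a0 μ ν m → All (_≢ 0ℤ) μ → All (_≢ 0ℤ) ν → sum (map ∣_∣ μ) ≡ m → sum (map ∣_∣ ν) ≡ m →
        (∀ k → a0 < k → k < a0 + m → (SIn a0 μ k → SIn a0 ν k) × (SIn a0 ν k → SIn a0 μ k)) →
        (∀ k → a0 < k → k ≤ a0 + m → (TIn a0 μ k → TIn a0 ν k) × (TIn a0 ν k → TIn a0 μ k)) → μ ≡ ν
  profile-injective a0 [] [] m _ _ _ _ _ _ = refl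
  profile-injective a0 [] (w ∷ ws) m _ (hw ∷ _) s s' _ _ = ⊥-elim (nonempty-sum w ws m hw s' (sym s))
  profile-injective a0 (z ∷ zs) [] m (hz ∷ _) _ s s' _ _ = ⊥-elim (nonempty-sum z zs m hz s (sym s'))
  profile-injective a0 (z ∷ zs) (w ∷ ws) m (hz ∷ hzs) (hw ∷ hws) s s' HS HT = cong₂ _∷_ z≡w (tails z≡w)
    where
    m≥ : ∀ x xs → sum (map ∣_∣ (x ∷ xs)) ≡ m → ∣ x ∣ ≤ m
    m≥ x xs e = subst (∣ x ∣ ≤_) e (m≤m+n ∣ x ∣ _)
    abs-eq : ∣ z ∣ ≡ ∣ w ∣
    abs-eq with <-cmp ∣ z ∣ ∣ w ∣
    ... | tri≈ _ e _ = e
    ... | tri< lt _ _ with short-block a0 z zs w ws hz lt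
    ...   | inν , notμ = ⊥-elim (notμ (proj₂ (HS (a0 + ∣ z ∣) (m<m+n a0 (abs-pos z hz)) (<-≤-trans (+-monoʳ-< a0 lt) (+-monoʳ-≤ a0 (m≥ w ws s')))) inν))
    abs-eq | tri> _ _ gt with short-block a0 w ws z zs hw gt
    ...   | inμ , notν = ⊥-elim (notν (proj₁ (HS (a0 + ∣ w ∣) (m<m+n a0 (abs-pos w hw)) (<-≤-trans (+-monoʳ-< a0 gt) (+-monoʳ-≤ a0 (m≥ z zs s)))) inμ))
    z≡w : z ≡ w
    z≡w = ℤ-by-abs-sign z w hz abs-eq
      (λ p → proj₁ (head-T a0 w ws hw) (proj₁ (HT (suc a0) (n<1+n a0) one≤ ) (proj₂ (head-T a0 z zs hz) p)))
      (λ p → proj₁ (head-T a0 z zs hz) (proj₂ (HT (suc a0) (n<1+n a0) one≤ ) (proj₂ (head-T a0 w ws hw) p)))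
      where
      one≤ : suc a0 ≤ a0 + m
      one≤ = subst (_≤ a0 + m) (+-comm a0 1) (+-monoʳ-≤ a0 (≤-trans (abs-pos z hz) (m≥ z zs s)))
    tails : z ≡ w → zs ≡ ws
    tails refl = profile-injective a1 zs ws (sum (map ∣_∣ zs)) hzs hws refl sws
        (λ k lt lt' → (λ x → S-cons a0 z ws k (<⇒≤ lt) (proj₁ (HS k (lift lt) (lift' lt')) (there x))) ,
                      (λ x → S-cons a0 z zs k (<⇒≤ lt) (proj₂ (HS k (lift lt) (lift' lt')) (there x))))
        (λ k lt lt' → (λ x → T-cons a0 z ws k lt (proj₁ (HT k (lift lt) (lift'≤ lt')) (there x))) ,
                      (λ x → T-cons a0 z zs k lt (proj₂ (HT k (lift lt) (lift'≤ lt')) (there x))))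
      where
      a1 : ℕ
      a1 = a0 + ∣ z ∣
      sws : sum (map ∣_∣ ws) ≡ sum (map ∣_∣ zs)
      sws = +-cancelˡ-≡ ∣ z ∣ _ _ (trans s' (sym s))
      eqm : a1 + sum (map ∣_∣ zs) ≡ a0 + m
      eqm = trans (+-assoc a0 ∣ z ∣ _) (cong (λ t → a0 + t) s)
      lift : ∀ {k} → a1 < k → a0 < k
      lift lt = ≤-<-trans (m≤m+n a0 ∣ z ∣) lt
      lift' : ∀ {k} → k < a1 + sum (map ∣_∣ zs) → k < a0 + m
      lift' {k} lt = subst (k <_) eqm lt
      lift'≤ : ∀ {k} → k ≤ a1 + sum (map ∣_∣ zs) → k ≤ a0 + m
      lift'≤ {k} lt = subst (k ≤_) eqm lt


module TestElements (r0 n' : ℕ) where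

  open import Data.Nat hiding (_≟_)
  open import Data.Nat.Properties
  open import Data.Integer using (ℤ)
  open import Data.Bool using (Bool; true; false; not; _∧_; _∨_)
  open import Data.Fin using (toℕ) renaming (zero to fz; suc to fs)
  open import Data.List using (List; []; _∷_; _++_; length)
  open import Data.List.Properties using (++-assoc; ++-identityʳ)
  open import Data.List.Relation.Unary.All using ([]; _∷_)
  open import Data.List.Relation.Unary.Any using (Any; here)
  open import Data.Product using (_×_; _,_; proj₁; proj₂; Σ)
  open import Data.Sum using (_⊎_; inj₁; inj₂)
  open import Data.Empty using (⊥-elim)
  open import Relation.Nullary using (Dec; yes; no; ¬_; does)
  open import Relation.Binary.PropositionalEquality hiding ([_]; _≗_)
  open Counting using (sw; sw-m; sw-sm; sw-id; does-true; does-iff)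
  open import Relation.Nullary.Decidable using (dec-true)
  open import Defs
  open G (suc (suc r0)) (suc n')
  open Profiles
  open Model r0 (suc n') using (ev; _·_)
  open Letters (suc (suc r0)) n' using (toF; toℕ-toF)
  open WordCongruence (suc (suc r0)) (suc n')
  open PiWords (suc (suc r0)) n'
  open Rows

  n : ℕ
  n = suc n'

  -- The data of a signed composition ν used by the test elements: cutF ν j says
  -- that 1 ≤ j < n is a block boundary (s_j ∉ Π_ν); Vf ν a says that position a
  -- (that is, t_{a+1}) lies outside the positive blocks; blkF ν a is the index of
  -- the ν-block containing position a.
  bit : Bool → ℕ
  bit true = 1
  bit false = 0

  cutF : List ℤ → ℕ → Bool
  cutF ν j = (1 ≤ᵇ j) ∧ ((j ≤ᵇ n') ∧ not (sB ν j))

  Vf : List ℤ → ℕ → Bool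
  Vf ν a = not (tB ν (suc a))

  blkF : List ℤ → ℕ → ℕ
  blkF ν zero = 0
  blkF ν (suc a) = blkF ν a + bit (not (sB ν (suc a)))

  ∧-true : ∀ {a b} → a ∧ b ≡ true → a ≡ true × b ≡ true
  ∧-true {true} {true} _ = refl , refl

  cutF-info : ∀ ν j → cutF ν j ≡ true → 1 ≤ j × j ≤ n' × sB ν j ≡ false
  cutF-info ν j h with ∧-true {1 ≤ᵇ j} h
  ... | h1 , h2 with ∧-true {j ≤ᵇ n'} h2
  ... | h3 , h4 = ≤ᵇ⇒≤ 1 j (subst Data.Bool.T (sym h1) _) , ≤ᵇ⇒≤ j n' (subst Data.Bool.T (sym h3) _) , lem (sB ν j) h4
    where
    lem : ∀ b → not b ≡ true → b ≡ false
    lem false _ = refl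

  cutFb : ∀ ν g → cutF ν g ≡ true → g ≤ n'
  cutFb ν g h = proj₁ (proj₂ (cutF-info ν g h))

  cutF-intro : ∀ ν j → 1 ≤ j → j ≤ n' → sB ν j ≡ false → cutF ν j ≡ true
  cutF-intro ν j h1 h2 h3 rewrite h3 = lem (≤⇒≤ᵇ h1) (≤⇒≤ᵇ h2)
    where
    lem : Data.Bool.T (1 ≤ᵇ j) → Data.Bool.T (j ≤ᵇ n') → (1 ≤ᵇ j) ∧ ((j ≤ᵇ n') ∧ true) ≡ true
    lem t1 t2 with 1 ≤ᵇ j | j ≤ᵇ n'
    ... | true | true = refl

  allB : ℕ → (ℕ → Bool) → Bool
  allB zero p = true
  allB (suc m) p = allB m p ∧ p m

  allB-true : ∀ m p → allB m p ≡ true → ∀ j → j < m → p j ≡ true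
  allB-true (suc m) p h j j<m with ∧-true {allB m p} h | m≤n⇒m<n∨m≡n (≤-pred j<m)
  ... | h1 , h2 | inj₁ lt = allB-true m p h1 j lt
  ... | h1 , h2 | inj₂ refl = h2

  allB-false : ∀ m p → allB m p ≡ false → Σ ℕ λ j → j < m × p j ≡ false
  allB-false (suc m) p h with allB m p in e1 | p m in e2
  ... | false | _ with allB-false m p e1
  ...   | j , lt , pj = j , <-trans lt (n<1+n m) , pj
  allB-false (suc m) p h | true | false = m , n<1+n m , e2
  allB-false (suc m) p () | true | true

  cut-ok : List ℤ → List ℤ → ℕ → Bool
  cut-ok μ ν j = not (cutF μ j) ∨ not (sB ν j)

  colour-ok : List ℤ → List ℤ → ℕ → Bool
  colour-ok μ ν a = not (Vf μ a) ∨ Vf ν a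

  dominates : List ℤ → List ℤ → Bool
  dominates μ ν = allB n (cut-ok μ ν) ∧ allB n (colour-ok μ ν)

  dominates-true : ∀ μ ν → dominates μ ν ≡ true →
    (∀ j → cutF μ j ≡ true → sB ν j ≡ false) × (∀ a → a < n → Vf μ a ≡ true → Vf ν a ≡ true)
  dominates-true μ ν h with ∧-true {allB n (cut-ok μ ν)} h
  ... | h1 , h2 = (λ j cj → lemS j cj (allB-true n (cut-ok μ ν) h1 j (s≤s (cutFb μ j cj)))) ,
                  (λ a a<n va → lemT a va (allB-true n (colour-ok μ ν) h2 a a<n))
    where
    lemS : ∀ j → cutF μ j ≡ true → cut-ok μ ν j ≡ true → sB ν j ≡ false
    lemS j cj o rewrite cj with sB ν j
    ... | false = refl
    lemS j cj () | true
    lemT : ∀ a → Vf μ a ≡ true → colour-ok μ ν a ≡ true → Vf ν a ≡ true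
    lemT a va o rewrite va = o

  dominates-false : ∀ μ ν → dominates μ ν ≡ false →
    (Σ ℕ λ j → cutF μ j ≡ true × sB ν j ≡ true) ⊎ (Σ ℕ λ a → a < n × Vf μ a ≡ true × Vf ν a ≡ false)
  dominates-false μ ν h with allB n (cut-ok μ ν) in e1
  ... | false with allB-false n (cut-ok μ ν) e1
  ...   | j , _ , oj = inj₁ (j , lemS (cutF μ j) (sB ν j) oj)
    where
    lemS : ∀ a b → not a ∨ not b ≡ false → a ≡ true × b ≡ true
    lemS true true _ = refl , refl
  dominates-false μ ν h | true with allB-false n (colour-ok μ ν) h
  ... | a , lt , oa = inj₂ (a , lt , lemT (Vf μ a) (Vf ν a) oa)
    where
    lemT : ∀ a b → not a ∨ b ≡ false → a ≡ true × b ≡ false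
    lemT true false _ = refl , refl

  dominates-refl : ∀ μ → dominates μ μ ≡ true
  dominates-refl μ = lem (allB-intro n (cut-ok μ μ) (λ j _ → s-ok j)) (allB-intro n (colour-ok μ μ) (λ a _ → t-ok a))
    where
    allB-intro : ∀ m p → (∀ j → j < m → p j ≡ true) → allB m p ≡ true
    allB-intro zero p h = refl
    allB-intro (suc m) p h rewrite allB-intro m p (λ j lt → h j (<-trans lt (n<1+n m))) = h m (n<1+n m)
    s-ok : ∀ j → cut-ok μ μ j ≡ true
    s-ok j with cutF μ j in e
    ... | false = refl
    ... | true rewrite proj₂ (proj₂ (cutF-info μ j e)) = refl
    t-ok : ∀ a → colour-ok μ μ a ≡ true
    t-ok a with Vf μ a
    ... | false = refl
    ... | true = refl
    lem : ∀ {a b} → a ≡ true → b ≡ true → a ∧ b ≡ true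
    lem refl refl = refl

  blk-mono : ∀ ν a b → a ≤ b → blkF ν a ≤ blkF ν b
  blk-mono ν a zero z≤n = z≤n
  blk-mono ν a (suc b) a≤ with m≤n⇒m<n∨m≡n a≤
  ... | inj₂ refl = ≤-refl
  ... | inj₁ (s≤s a≤b) = ≤-trans (blk-mono ν a b a≤b) (m≤m+n (blkF ν b) _)

  inΠ-sE' : ∀ ν j → 1 ≤ j → j ≤ n' → SIn 0 ν j → InΠ ν (sE' j)
  inΠ-sE' ν j h1 h2 s with toF {n'} j in e
  ... | fz = ⊥-elim (<-irrefl refl (<-≤-trans (s≤s z≤n) (≤-trans h1 (≤-reflexive (trans (sym (toℕ-toF j h2)) (cong toℕ e))))))
  ... | fs x = subst (SIn 0 ν) (trans (sym (toℕ-toF j h2)) (cong toℕ e)) s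

  inΠ-tE' : ∀ ν a → a ≤ n' → TIn 0 ν (suc a) → InΠ ν (tE' a)
  inΠ-tE' ν a a≤ t = subst (λ k → TIn 0 ν (suc k)) (sym (toℕ-toF a a≤)) t

  -- Θ_ν is invariant under left multiplication by Π_ν: t_{j+1} ∈ Π_ν means
  -- j ∉ V_ν, and s_{m+1} ∈ Π_ν means that m, m+1 lie in one ν-block, which is
  -- positive or not as a whole.
  module _ (ν : List ℤ) where
    open Statistic r0 n (blkF ν) (Vf ν) using (Θ)
    open LengthBound r0 n (blkF ν) (Vf ν)

    Θν-left-Π : ∀ P → InΠ ν P → ∀ x → Θ (ev (piWord P) · x) ≡ Θ x
    Θν-left-Π (tE j) t x = inv-tE j x (cong not (dec-true (TIn? 0 ν (suc (toℕ j))) t))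
    Θν-left-Π (sE j p) s x = go (toℕ j) refl p
      where
      go : ∀ k → toℕ j ≡ k → 1 ≤ k → Θ (ev (piWord (sE j p)) · x) ≡ Θ x
      go (suc m) eq _ = inv-sE j p x m eq same-block V-sw
        where
        sm : SIn 0 ν (suc m)
        sm = subst (SIn 0 ν) eq s
        same-block : blkF ν m ≡ blkF ν (suc m)
        same-block rewrite dec-true (SIn? 0 ν (suc m)) sm = sym (+-identityʳ (blkF ν m))
        same-V : Vf ν m ≡ Vf ν (suc m)
        same-V = cong not (does-iff (TIn? 0 ν (suc m)) (TIn? 0 ν (suc (suc m)))
                   (proj₁ (interior-gap-T 0 ν m sm)) (proj₂ (interior-gap-T 0 ν m sm)))
        V-sw : ∀ a → Vf ν (sw m a) ≡ Vf ν a
        V-sw a with a Data.Nat.≟ m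
        ... | yes refl = trans (cong (Vf ν) (sw-m a)) (sym same-V)
        ... | no a≢m with a Data.Nat.≟ suc m
        ...   | yes refl = trans (cong (Vf ν) (sw-sm m)) same-V
        ...   | no a≢sm = cong (Vf ν) (sw-id m a a≢m a≢sm)

    Θν-below-coset : ∀ h g k → InG ν h → ProdLen (h ++ g) k → Θ (ev g) ≤ k
    Θν-below-coset h g k inG pl =
      ≤-trans (≤-reflexive (sym (Invariance.subgroup-inv (InΠ ν) Θν-left-Π h g inG))) (Θ-below-length (h ++ g) k pl)

  module TestElement (μ : List ℤ) where

    open TestWord (suc (suc r0)) n' (cutF μ) refl (Vf μ) public
    open TestDescents (suc (suc r0)) n' (cutF μ) refl (cutFb μ) (Vf μ) public hiding (n)

    -- g_μ: colour the positions outside the positive blocks of μ, then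
    -- reverse every maximal interval of positions separated by cuts of μ.
    g : Word
    g = wordP xs

    rows-mem : ∀ a → a < n → Vf μ a ≡ true → Any (a ≡_) ts
    rows-mem a a<n h = go n a a<n h
      where
      go : ∀ m a → a < m → Vf μ a ≡ true → Any (a ≡_) (rowsUp (Vf μ) m)
      go (suc m) a a<m h with m≤n⇒m<n∨m≡n (≤-pred a<m)
      ... | inj₁ lt = Data.List.Relation.Unary.Any.Properties.++⁺ˡ (go m a lt h)
        where import Data.List.Relation.Unary.Any.Properties
      ... | inj₂ refl = Data.List.Relation.Unary.Any.Properties.++⁺ʳ (rowsUp (Vf μ) a) (lem (Vf μ a) h)
        where
        import Data.List.Relation.Unary.Any.Properties
        lem : ∀ b → b ≡ true → Any (a ≡_) (rowsB (Vf μ) b a)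
        lem true _ = here refl

    -- The test word is reduced: ℓ(g) ≥ length xs, by the statistic with
    -- every position its own block and every position coloured.
    g-length : ∀ k → ProdLen g k → length xs ≤ k
    g-length k pl = ≤-trans lower (Θ-below-length g k pl)
      where
      open LengthBound r0 n (λ a → a) (λ _ → true) using (Θ-below-length)
      cut-raises : ∀ x → cutF μ x ≡ true → pred x < x
      cut-raises zero ()
      cut-raises (suc x) _ = n<1+n x
      open TestLength.Bound r0 n' (cutF μ) refl (λ a → a) (λ _ → true) (Vf μ)
        (cutFb μ) (λ _ _ _ → refl) (λ a b h → h) cut-raises

    -- A left descent P ∈ Π_ν of the test word excludes it from ℰ_ν:
    -- P⁻¹ g ∈ G_ν g is shorter than g.
    descent-not-in-ℰ : ∀ ν P → InΠ ν P → PiDescent xs P → ¬ ℰ ν g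
    descent-not-in-ℰ ν P inP (ys , len , eq) E with E h inG (length ys) shorter
      where
      h : Word
      h = invW (piWord P)
      inG : InG ν h
      inG = (P , false) ∷ [] , inP ∷ [] , ≡→≈ (++-identityʳ h)
      shorter : ProdLen (h ++ g) (length ys)
      shorter = ys , refl , ≈sym (
        (h ++ g)
          ≈⟨ congˡ h eq ⟩
        (h ++ piWord P ++ wordP ys)
          ≈⟨ ≡→≈ (sym (++-assoc h (piWord P) (wordP ys))) ⟩
        ((h ++ piWord P) ++ wordP ys)
          ≈⟨ congʳ (wordP ys) (cancel-l (piWord P)) ⟩
        wordP ys ∎≈)
    ... | k , k≤ , pl = <-irrefl refl (<-≤-trans (subst (length ys <_) (sym len) (n<1+n _)) (≤-trans (g-length k pl) k≤))

    -- If μ ⋠ ν, the test element has a left descent in Π_ν: a cut of μ that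
    -- is interior for ν, or a coloured row of μ inside a positive ν-block.
    not-in-ℰ : ∀ ν → dominates μ ν ≡ false → ¬ ℰ ν g
    not-in-ℰ ν h with dominates-false μ ν h
    ... | inj₁ (j , cj , sj) with cutF-info μ j cj
    ...   | h1 , h2 , _ = descent-not-in-ℰ ν (sE' j) (inΠ-sE' ν j h1 h2 (does-true (SIn? 0 ν j) sj)) (s-desc j cj)
    not-in-ℰ ν h | inj₂ (a , a<n , va , vν) =
      descent-not-in-ℰ ν (tE' a) (inΠ-tE' ν a (≤-pred a<n) (does-true (TIn? 0 ν (suc a)) (not-false vν))) (t-desc a (rows-mem a a<n va))
      where
      not-false : ∀ {b} → not b ≡ false → b ≡ true
      not-false {true} _ = refl

    -- If μ ≼ ν, then Θ_ν(g) ≥ length xs ≥ ℓ(g), while Θ_ν(g) ≤ ℓ(h g) for all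
    -- h ∈ G_ν; hence g ∈ ℰ_ν.
    in-ℰ : ∀ ν → dominates μ ν ≡ true → ℰ ν g
    in-ℰ ν ok h inG k pl = length xs , ≤-trans lower (Θν-below-coset ν h g k inG pl) , (xs , refl , ≈refl)
      where
      cut-raises : ∀ x → cutF μ x ≡ true → blkF ν (pred x) < blkF ν x
      cut-raises zero ()
      cut-raises (suc x) cx rewrite proj₁ (dominates-true μ ν ok) (suc x) cx = subst (blkF ν x <_) (+-comm 1 (blkF ν x)) (n<1+n _)
      open TestLength.Bound r0 n' (cutF μ) refl (blkF ν) (Vf ν) (Vf μ)
        (cutFb μ) (proj₂ (dominates-true μ ν ok)) (blk-mono ν) cut-raises

    decide : ∀ ν b → dominates μ ν ≡ b → Dec (ℰ ν g)
    decide ν true e = yes (in-ℰ ν e)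
    decide ν false e = no (not-in-ℰ ν e)

    dec : ∀ ν → Dec (ℰ ν g)
    dec ν = decide ν (dominates μ ν) refl

    dec-does : ∀ ν → does (dec ν) ≡ dominates μ ν
    dec-does ν = go (dominates μ ν) refl
      where
      go : ∀ b (e : dominates μ ν ≡ b) → does (decide ν b e) ≡ b
      go true e = refl
      go false e = refl


module Weights (r0 n' : ℕ) where

  open import Data.Nat hiding (_≟_)
  open import Data.Nat.Properties
  open import Data.Integer using (ℤ)
  open import Data.Bool using (Bool; true; false; not)
  open import Data.Bool.Properties using (not-injective)
  open import Data.List using (List)
  open import Data.Product using (_×_; _,_; proj₁; proj₂)
  open import Relation.Binary.PropositionalEquality hiding ([_])
  open Counting using (Σ<; Σ-mono; Σ-ones; +-tight; Σ-tight; does-eq-iff)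
  open import Defs
  open Profiles
  open TestElements r0 n'

  wt : List ℤ → ℕ
  wt μ = Σ< n (λ j → bit (cutF μ j)) + Σ< n (λ a → bit (Vf μ a))

  bit-mono : ∀ {a b} → (a ≡ true → b ≡ true) → bit a ≤ bit b
  bit-mono {false} f = z≤n
  bit-mono {true} f rewrite f refl = ≤-refl

  bit-inj : ∀ {a b} → bit a ≡ bit b → a ≡ b
  bit-inj {true} {true} _ = refl
  bit-inj {false} {false} _ = refl

  bit≤1 : ∀ a → bit a ≤ 1
  bit≤1 true = ≤-refl
  bit≤1 false = z≤n

  wt-bound : ℕ
  wt-bound = n + n

  wt≤ : ∀ μ → wt μ ≤ wt-bound
  wt≤ μ = +-mono-≤ (≤-trans (Σ-mono n (λ j _ → bit≤1 (cutF μ j))) (≤-reflexive (Σ-ones n)))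
                   (≤-trans (Σ-mono n (λ a _ → bit≤1 (Vf μ a))) (≤-reflexive (Σ-ones n)))

  cutF-mono : ∀ μ ν → dominates μ ν ≡ true → ∀ j → cutF μ j ≡ true → cutF ν j ≡ true
  cutF-mono μ ν ok j cj with cutF-info μ j cj
  ... | h1 , h2 , _ = cutF-intro ν j h1 h2 (proj₁ (dominates-true μ ν ok) j cj)

  wt-mono : ∀ μ ν → dominates μ ν ≡ true → wt μ ≤ wt ν
  wt-mono μ ν ok = +-mono-≤ (Σ-mono n (λ j _ → bit-mono (cutF-mono μ ν ok j)))
                            (Σ-mono n (λ a a<n → bit-mono (proj₂ (dominates-true μ ν ok) a a<n)))

  cutF-val : ∀ X k → 1 ≤ k → k ≤ n' → cutF X k ≡ not (sB X k)
  cutF-val X k h1 h2 = lem (≤⇒≤ᵇ h1) (≤⇒≤ᵇ h2)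
    where
    lem : Data.Bool.T (1 ≤ᵇ k) → Data.Bool.T (k ≤ᵇ n') → cutF X k ≡ not (sB X k)
    lem t1 t2 with 1 ≤ᵇ k | k ≤ᵇ n'
    ... | true | true = refl

  wt-rigid : ∀ μ ν → dominates μ ν ≡ true → wt μ ≡ wt ν →
             (∀ j → j < n → cutF μ j ≡ cutF ν j) × (∀ a → a < n → Vf μ a ≡ Vf ν a)
  wt-rigid μ ν ok e =
    (λ j j<n → bit-inj (Σ-tight n _ _ cuts (proj₁ parts) j j<n)) ,
    (λ a a<n → bit-inj (Σ-tight n _ _ colours (proj₂ parts) a a<n))
    where
    cuts : ∀ j → j < n → bit (cutF μ j) ≤ bit (cutF ν j)
    cuts j _ = bit-mono (cutF-mono μ ν ok j)
    colours : ∀ a → a < n → bit (Vf μ a) ≤ bit (Vf ν a)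
    colours a a<n = bit-mono (proj₂ (dominates-true μ ν ok) a a<n)
    parts : Σ< n (λ j → bit (cutF μ j)) ≡ Σ< n (λ j → bit (cutF ν j)) ×
            Σ< n (λ a → bit (Vf μ a)) ≡ Σ< n (λ a → bit (Vf ν a))
    parts = +-tight (Σ-mono n cuts) (Σ-mono n colours) e

  -- Off the diagonal, ≼ strictly increases the weight: equal weights give
  -- equal profiles, hence equal compositions.
  wt-strict : ∀ μ ν → IsSignedComp n μ → IsSignedComp n ν → dominates μ ν ≡ true → ν ≢ μ → wt μ < wt ν
  wt-strict μ ν (nzμ , sμ) (nzν , sν) ok ne = ≤∧≢⇒< (wt-mono μ ν ok) (λ e → ne (sym (same e)))
    where
    same : wt μ ≡ wt ν → μ ≡ ν
    same e = profile-injective 0 μ ν n nzμ nzν sμ sν HS HT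
      where
      HS : ∀ k → 0 < k → k < 0 + n → (SIn 0 μ k → SIn 0 ν k) × (SIn 0 ν k → SIn 0 μ k)
      HS k h1 h2 = does-eq-iff (SIn? 0 μ k) (SIn? 0 ν k)
        (not-injective (trans (sym (cutF-val μ k h1 (≤-pred h2)))
          (trans (proj₁ (wt-rigid μ ν ok e) k h2) (cutF-val ν k h1 (≤-pred h2)))))
      HT : ∀ k → 0 < k → k ≤ 0 + n → (TIn 0 μ k → TIn 0 ν k) × (TIn 0 ν k → TIn 0 μ k)
      HT (suc a) h1 h2 = does-eq-iff (TIn? 0 μ (suc a)) (TIn? 0 ν (suc a)) (not-injective (proj₂ (wt-rigid μ ν ok e) a h2))


-- If
-- for every μ ∈ L the sum of the c_ν over ν ∈ L with μ ≼ ν vanishes, then all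
-- c_ν vanish: by descending induction on wt μ, every term of the μ-th sum
-- other than c_μ is already known to vanish.
module Unitriangular {c ℓ} (R : CommutativeRing c ℓ) {I : Set} (_≟_ : DecidableEquality I) where

  open import Data.Nat using (_∸_; _<_; _≤_)
  open import Data.Nat.Properties using (≤-refl; ≤-trans; ≤-pred; ∸-monoʳ-<)
  open import Data.List using (List; []; _∷_; map; foldr)
  open import Data.List.Relation.Unary.All using (All; []; _∷_)
  import Data.List.Relation.Unary.All as All
  open import Data.List.Relation.Unary.Any using (here; there)
  open import Data.List.Relation.Unary.AllPairs using ([]; _∷_)
  open import Data.List.Membership.Propositional using (_∈_)
  open import Data.Empty using (⊥-elim)
  open import Relation.Nullary using (yes; no)
  import Relation.Binary.PropositionalEquality as ≡
  open ≡ using (_≢_)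
  open CommutativeRing R renaming (Carrier to A)
  open import Relation.Binary.Reasoning.Setoid setoid

  sumL : List I → (I → A) → A
  sumL L f = foldr _+_ 0# (map f L)

  sum-zero : ∀ L (f : I → A) → (∀ ν → ν ∈ L → f ν ≈ 0#) → sumL L f ≈ 0#
  sum-zero [] f h = refl
  sum-zero (x ∷ L) f h = trans (+-cong (h x (here ≡.refl)) (sum-zero L f (λ ν m → h ν (there m)))) (+-identityˡ 0#)

  sum-focus : ∀ L (f : I → A) μ → Unique L → μ ∈ L → (∀ ν → ν ∈ L → ν ≢ μ → f ν ≈ 0#) → sumL L f ≈ f μ
  sum-focus (x ∷ L) f μ (x∉L ∷ u) m h with x ≟ μ
  ... | yes ≡.refl = trans (+-cong refl (sum-zero L f (λ ν m' → h ν (there m') (λ e → All.lookup x∉L m' (≡.sym e))))) (+-identityʳ (f x))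
  ... | no x≢μ with m
  ...   | here e = ⊥-elim (x≢μ (≡.sym e))
  ...   | there m' = trans (+-cong (h x (here ≡.refl) x≢μ) (sum-focus L f μ u m' (λ ν m'' ne → h ν (there m'') ne))) (+-identityˡ (f μ))

  row : List I → (I → I → Bool) → (I → A) → I → A
  row L _≼_ coef μ = sumL L (λ ν → if μ ≼ ν then coef ν else 0#)

  unitriangular : (L : List I) → Unique L → (_≼_ : I → I → Bool) (wt : I → ℕ) (B : ℕ) →
    (∀ μ → μ ≼ μ ≡ true) →
    (∀ {μ ν} → μ ∈ L → ν ∈ L → μ ≼ ν ≡ true → ν ≢ μ → wt μ < wt ν) →
    (∀ {ν} → ν ∈ L → wt ν ≤ B) →
    (coef : I → A) → (∀ {μ} → μ ∈ L → row L _≼_ coef μ ≈ 0#) →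
    All (λ μ → coef μ ≈ 0#) L
  unitriangular L uniq _≼_ wt B ≼-refl strict bounded coef rows =
    All.tabulate (λ {μ} m → vanish (suc (B ∸ wt μ)) μ m ≤-refl)
    where
    vanish : ∀ k μ → μ ∈ L → B ∸ wt μ < k → coef μ ≈ 0#
    vanish (suc k) μ m lt = begin
      coef μ                                        ≈⟨ reflexive (≡.cong (λ b → if b then coef μ else 0#) (≡.sym (≼-refl μ))) ⟩
      (if μ ≼ μ then coef μ else 0#)                ≈⟨ sym (sum-focus L _ μ uniq m others) ⟩
      row L _≼_ coef μ                               ≈⟨ rows m ⟩
      0#                                            ∎
      where
      others : ∀ ν → ν ∈ L → ν ≢ μ → (if μ ≼ ν then coef ν else 0#) ≈ 0#
      others ν mν ne with μ ≼ ν in e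
      ... | false = refl
      ... | true = vanish k ν mν (≤-trans (∸-monoʳ-< (strict m mν e ne) (bounded mν)) (≤-pred lt))


module TestCoefficients {c ℓ} (R : CommutativeRing c ℓ) (r0 n' : ℕ) where

  open import Data.Integer as ℤ using (ℤ)
  open import Data.List using (foldr)
  open import Data.List.Properties using (≡-dec; map-cong)
  open import Relation.Binary.PropositionalEquality using (cong; trans; sym)
  open Counting using (isYes≡does)
  open TestElements r0 n'
  open Unitriangular R (≡-dec ℤ._≟_) using (row)

  coeffAt-test : ∀ L coef μ → row L dominates coef μ ≡ coeffAt R L coef (TestElement.dec μ)
  coeffAt-test L coef μ = sym (cong (foldr _ _) (map-cong
    (λ ν → cong (λ b → if b then coef ν else _) (trans (isYes≡does (TestElement.dec μ ν)) (TestElement.dec-does μ ν))) L))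


proposition6p5 : ∀ {c ℓ} (R : CommutativeRing c ℓ) (r n : ℕ) → 1 < r → 1 ≤ n →
    (L : List (List ℤ)) → All (IsSignedComp n) L → Unique L →
    (coef : List ℤ → CommutativeRing.Carrier R) →
    (∀ (g : G.Word r n) (d : ∀ μ → Dec (G.ℰ r n μ g)) →
    CommutativeRing._≈_ R (coeffAt R L coef d) (CommutativeRing.0# R)) →
    All (λ μ → CommutativeRing._≈_ R (coef μ) (CommutativeRing.0# R)) L
proposition6p5 R (suc (suc r0)) (suc n') (s≤s (s≤s z≤n)) (s≤s z≤n) L comps uniq coef vanishes =
  unitriangular L uniq dominates wt wt-bound dominates-refl
    (λ mμ mν → wt-strict _ _ (AllM.lookup comps mμ) (AllM.lookup comps mν))
    (λ {ν} _ → wt≤ ν) coef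
    (λ {μ} _ → R.trans (R.reflexive (coeffAt-test L coef μ)) (vanishes (TestElement.g μ) (TestElement.dec μ)))
  where
  module R = CommutativeRing R
  open TestElements r0 n'
  open Weights r0 n'
  open Unitriangular R (≡-dec ℤ._≟_)
  open TestCoefficients R r0 n'
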